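{- For every consistent $\mathrm{LE}$-$\mathcal{FALC}$ ABox $\mathcal{A}$ there exists a model of $\mathcal{A}$ (an interpretation based on an $\mathbf{H}$-valued enriched formal context $(A,X,I,\ldots)$) whose size $|A|+|X|$ is polynomial in the size of $\mathcal{A}$.
   Context: Let $\mathbf{H}=(H,\vee,\wedge,\to,1,0)$ be a complete and completely distributive Heyting algebra. For a nonempty set $W$, $\mathbf{H}^W$ is the set of maps $W\to\mathbf{H}$, ordered pointwise; $\{\alpha/w\}$ sends $w$ to $\alpha$ and all else to $0$. An $\mathbf{H}$-relation $R:U\times W\to\mathbf{H}$ induces $R^{(1)}[f](w)=\bigwedge_{u\in U}(f(u)\to R(u,w))$ and $R^{(0)}[g](u)=\bigwedge_{w\in W}(g(w)\to R(u,w))$. For $I:A\times X\to\mathbf{H}$ write $f^\uparrow=I^{(1)}[f]$, $u^\downarrow=I^{(0)}[u]$; Galois-stable means $f^{\uparrow\downarrow}=f$, resp. $u^{\downarrow\uparrow}=u$. A fuzzy formal concept is $c=(\mathrm{ext}(c),\mathrm{int}(c))$ with $\mathrm{ext}(c)^\uparrow=\mathrm{int}(c)$, $\mathrm{int}(c)^\downarrow=\mathrm{ext}(c)$. An $\mathbf{H}$-valued enriched formal context is $(A,X,I,\{R_\Box\}_{\Box\in\mathcal{G}},\{R_\Diamond\}_{\Diamond\in\mathcal{F}})$ with $A,X$ nonempty, $R_\Box:A\times X\to\mathbf{H}$, $R_\Diamond:X\times A\to\mathbf{H}$ $I$-compatible: for all $a,x,\alpha$, $R_\Box^{(0)}[\{\alpha/x\}]$,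 $R_\Box^{(1)}[\{\alpha/a\}]$, $R_\Diamond^{(0)}[\{\alpha/a\}]$, $R_\Diamond^{(1)}[\{\alpha/x\}]$ are Galois-stable. Operations: $c_1\wedge c_2=(\mathrm{ext}(c_1)\wedge\mathrm{ext}(c_2),(\mathrm{ext}(c_1)\wedge\mathrm{ext}(c_2))^\uparrow)$; $c_1\vee c_2=((\mathrm{int}(c_1)\wedge\mathrm{int}(c_2))^\downarrow,\mathrm{int}(c_1)\wedge\mathrm{int}(c_2))$; $[R_\Box]c=(R_\Box^{(0)}[\mathrm{int}(c)],(R_\Box^{(0)}[\mathrm{int}(c)])^\uparrow)$; $\langle R_\Diamond\rangle c=((R_\Diamond^{(0)}[\mathrm{ext}(c)])^\downarrow,R_\Diamond^{(0)}[\mathrm{ext}(c)])$. Syntax of $\mathrm{LE}$-$\mathcal{FALC}$: disjoint sets of object names and feature names; role names $I$, $R_\Box$ ($\Box\in\mathcal{G}$, finite), $R_\Diamond$ ($\Diamond\in\mathcal{F}$, finite); concepts $C::=D\mid C_1\wedge C_2\mid C_1\vee C_2\mid [R_\Box]C\mid\langle R_\Diamond\rangle C$ with $D$ primitive. ABox terms: $b:C$, $y::C$, $I(b,y)$, $R_\Box(b,y)$, $R_\Diamond(y,b)$. Assertions: $\alpha\le t$, $\alpha\not\le t$ with $\alpha\in\mathbf{H}$; an ABox is a finite set of assertions. An interpretation $\mathcal{M}$ consists of an $\mathbf{H}$-valued enriched formal context and a map sending object names into $A$, feature names into $X$, role names to the corresponding relations, primitive concepts to fuzzy formal concepts, extended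 to all concepts by the operations above. Valuation: $v(b:C)=\mathrm{ext}(C^{\mathcal{M}})(b^{\mathcal{M}})$, $v(y::C)=\mathrm{int}(C^{\mathcal{M}})(y^{\mathcal{M}})$, $v(I(b,y))=I(b^{\mathcal{M}},y^{\mathcal{M}})$, similarly for $R_\Box$, $R_\Diamond$. $\mathcal{M}\models\alpha\le t$ iff $\alpha\le v(t)$; $\mathcal{M}\models\alpha\not\le t$ iff not $\mathcal{M}\models\alpha\le t$. A model of $\mathcal{A}$ satisfies all its assertions; $\mathcal{A}$ is consistent if it has a model. -}

module Defs where

open import Data.Nat using (ℕ; suc; _+_)
open import Data.Fin using (Fin)
open import Data.List using (List; []; _∷_)
open import Data.Product using (Σ; _×_)
open import Relation.Binary.PropositionalEquality using (_≡_)
open import Relation.Nullary using (¬_)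

record CCDHeyting : Set₁ where
  infix  4 _≤_
  infixr 7 _∧_
  infixr 6 _∨_
  infixr 5 _⇒_
  field
    H        : Set
    _≤_      : H → H → Set
    ≤-refl   : ∀ {x} → x ≤ x
    ≤-trans  : ∀ {x y z} → x ≤ y → y ≤ z → x ≤ z
    ≤-antisym : ∀ {x y} → x ≤ y → y ≤ x → x ≡ y
    _∧_ _∨_ _⇒_ : H → H → H
    ⊤ ⊥      : H
    ∧-lbˡ    : ∀ x y → x ∧ y ≤ x
    ∧-lbʳ    : ∀ x y → x ∧ y ≤ y
    ∧-glb    : ∀ {x y z} → z ≤ x → z ≤ y → z ≤ x ∧ y
    ∨-ubˡ    : ∀ x y → x ≤ x ∨ y
    ∨-ubʳ    : ∀ x y → y ≤ x ∨ y
    ∨-lub    : ∀ {x y z} → x ≤ z → y ≤ z → x ∨ y ≤ z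
    ⊤-max    : ∀ x → x ≤ ⊤
    ⊥-min    : ∀ x → ⊥ ≤ x
    ⇒-intro  : ∀ {x y z} → z ∧ x ≤ y → z ≤ x ⇒ y
    ⇒-elim   : ∀ {x y z} → z ≤ x ⇒ y → z ∧ x ≤ y
    ⋀ ⋁      : {I : Set} → (I → H) → H
    ⋀-lb     : ∀ {I : Set} (f : I → H) (i : I) → ⋀ f ≤ f i
    ⋀-glb    : ∀ {I : Set} (f : I → H) {z} → (∀ i → z ≤ f i) → z ≤ ⋀ f
    ⋁-ub     : ∀ {I : Set} (f : I → H) (i : I) → f i ≤ ⋁ f
    ⋁-lub    : ∀ {I : Set} (f : I → H) {z} → (∀ i → f i ≤ z) → ⋁ f ≤ z
    completely-distributive :
      ∀ {I : Set} {J : I → Set} (x : (i : I) → J i → H) →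
      ⋀ (λ i → ⋁ (λ j → x i j)) ≡ ⋁ (λ (f : (i : I) → J i) → ⋀ (λ i → x i (f i)))

module LE-FALC (𝓗 : CCDHeyting) (nG nF : ℕ) where
  open CCDHeyting 𝓗

  _⁽¹⁾[_] : {U W : Set} → (U → W → H) → (U → H) → (W → H)
  (R ⁽¹⁾[ f ]) w = ⋀ (λ u → f u ⇒ R u w)

  _⁽⁰⁾[_] : {U W : Set} → (U → W → H) → (W → H) → (U → H)
  (R ⁽⁰⁾[ g ]) u = ⋀ (λ w → g w ⇒ R u w)

  -- {α/w}: sends w to α and everything else to 0 (written constructively
  -- as the join of α over proofs of v ≡ w; classically this is the
  -- intended map).
  ⟨_/_⟩ : {W : Set} → H → W → (W → H)
  ⟨ α / w ⟩ v = ⋁ (λ (_ : v ≡ w) → α)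

  _≐_ : {W : Set} → (W → H) → (W → H) → Set
  f ≐ g = ∀ w → f w ≡ g w

  StableA : {A X : Set} → (A → X → H) → (A → H) → Set
  StableA I f = (I ⁽⁰⁾[ I ⁽¹⁾[ f ] ]) ≐ f

  StableX : {A X : Set} → (A → X → H) → (X → H) → Set
  StableX I u = (I ⁽¹⁾[ I ⁽⁰⁾[ u ] ]) ≐ u

  ObjName FeatName PrimName : Set
  ObjName  = ℕ
  FeatName = ℕ
  PrimName = ℕ

  data Concept : Set where
    prim : PrimName → Concept
    _⊓_  : Concept → Concept → Concept
    _⊔_  : Concept → Concept → Concept
    [_]_ : Fin nG → Concept → Concept
    ⟨_⟩_ : Fin nF → Concept → Concept

  data Term : Set where
    _∶_    : ObjName → Concept → Term
    _∷∶_   : FeatName → Concept → Term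
    I[_,_] : ObjName → FeatName → Term
    R□[_]  : Fin nG → ObjName → FeatName → Term
    R◇[_]  : Fin nF → FeatName → ObjName → Term

  data Assertion : Set where
    _≤ₐ_ : H → Term → Assertion
    _≰ₐ_ : H → Term → Assertion

  ABox : Set
  ABox = List Assertion

  conceptSize : Concept → ℕ
  conceptSize (prim _)  = 1
  conceptSize (C ⊓ D)   = suc (conceptSize C + conceptSize D)
  conceptSize (C ⊔ D)   = suc (conceptSize C + conceptSize D)
  conceptSize ([ _ ] C) = suc (conceptSize C)
  conceptSize (⟨ _ ⟩ C) = suc (conceptSize C)

  termSize : Term → ℕ
  termSize (_ ∶ C)     = suc (conceptSize C)
  termSize (_ ∷∶ C)    = suc (conceptSize C)
  termSize I[ _ , _ ]  = 3
  termSize (R□[ _ ] _ _) = 3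
  termSize (R◇[ _ ] _ _) = 3

  assertionSize : Assertion → ℕ
  assertionSize (_ ≤ₐ t) = 2 + termSize t
  assertionSize (_ ≰ₐ t) = 2 + termSize t

  aboxSize : ABox → ℕ
  aboxSize []       = 0
  aboxSize (φ ∷ 𝒜) = assertionSize φ + aboxSize 𝒜

  record Interpretation : Set₁ where
    field
      A X  : Set
      a₀   : A
      x₀   : X
      I    : A → X → H
      R□   : Fin nG → A → X → H
      R◇   : Fin nF → X → A → H
      R□-compat₀ : ∀ g (x : X) α → StableA I ((R□ g) ⁽⁰⁾[ ⟨ α / x ⟩ ])
      R□-compat₁ : ∀ g (a : A) α → StableX I ((R□ g) ⁽¹⁾[ ⟨ α / a ⟩ ])
      R◇-compat₀ : ∀ d (a : A) α → StableX I ((R◇ d) ⁽⁰⁾[ ⟨ α / a ⟩ ])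
      R◇-compat₁ : ∀ d (x : X) α → StableA I ((R◇ d) ⁽¹⁾[ ⟨ α / x ⟩ ])
      obj  : ObjName → A
      feat : FeatName → X
      primExt : PrimName → A → H
      primInt : PrimName → X → H
      prim-up   : ∀ p → (I ⁽¹⁾[ primExt p ]) ≐ primInt p
      prim-down : ∀ p → (I ⁽⁰⁾[ primInt p ]) ≐ primExt p

    _↑ : (A → H) → (X → H)
    f ↑ = I ⁽¹⁾[ f ]

    _↓ : (X → H) → (A → H)
    u ↓ = I ⁽⁰⁾[ u ]

    mutual
      ext : Concept → A → H
      ext (prim p)  = primExt p
      ext (C ⊓ D)   = λ a → ext C a ∧ ext D a
      ext (C ⊔ D)   = (λ x → int C x ∧ int D x) ↓
      ext ([ g ] C) = (R□ g) ⁽⁰⁾[ int C ]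
      ext (⟨ d ⟩ C) = ((R◇ d) ⁽⁰⁾[ ext C ]) ↓

      int : Concept → X → H
      int (prim p)  = primInt p
      int (C ⊓ D)   = (λ a → ext C a ∧ ext D a) ↑
      int (C ⊔ D)   = λ x → int C x ∧ int D x
      int ([ g ] C) = ((R□ g) ⁽⁰⁾[ int C ]) ↑
      int (⟨ d ⟩ C) = (R◇ d) ⁽⁰⁾[ ext C ]

    val : Term → H
    val (b ∶ C)       = ext C (obj b)
    val (y ∷∶ C)      = int C (feat y)
    val I[ b , y ]    = I (obj b) (feat y)
    val (R□[ g ] b y) = R□ g (obj b) (feat y)
    val (R◇[ d ] y b) = R◇ d (feat y) (obj b)

  open Interpretation public using (A; X; val)

  _⊨_ : Interpretation → Assertion → Set
  M ⊨ (α ≤ₐ t) = α ≤ val M t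
  M ⊨ (α ≰ₐ t) = ¬ (α ≤ val M t)

  data _⊨ᴬ_ (M : Interpretation) : ABox → Set where
    []  : M ⊨ᴬ []
    _∷_ : ∀ {φ 𝒜} → M ⊨ φ → M ⊨ᴬ 𝒜 → M ⊨ᴬ (φ ∷ 𝒜)

  Consistent : ABox → Set₁
  Consistent 𝒜 = Σ Interpretation (λ M → M ⊨ᴬ 𝒜)

-- Take any model M of 𝒜 and filtrate it.  A point of the new
-- context is a node p of the tree of modal contexts of the subconcept
-- occurrences of 𝒜, together with an extent x of M.  The incidence between an
-- object (p , x) and a feature (p , y) is the subsethood degree x ≼ y, and it is ⊤
-- between different paths; R□ g links p to g ∷ p with degree x ≼ □ g y, and R◇ d
-- links d ∷ p to p with degree ◇ d x ≼ y, for the operators □ g and ◇ d that M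
-- induces on extents.  Closing the points under these operators and their
-- adjoints along the paths (plus witnesses at the root) makes every row and column
-- of the modal relations dominated by, and attained at, a row or column of the
-- incidence; so they are Galois-stable and the context is enriched.  By induction
-- on concepts, an occurrence of C at path p is interpreted at (p , x) by x ≼ ext C,
-- which at the root gives back M's values of all terms of 𝒜.  With s the size of
-- 𝒜 there are O(s³) paths and base extents, hence O(s⁹) transported points; the
-- root witnesses are transported once more, whence |A| + |X| = O((s + 1)¹⁵).

module Submission where

open import Defs
open import Data.Bool using (Bool; true; false)
import Data.Bool as Bool
open import Data.Nat using (ℕ; suc; _+_; _*_; _^_; _≤_; z≤n; s≤s)
import Data.Nat.Properties as ℕ
open import Data.Fin using (Fin; zero; suc)
import Data.Fin.Properties as Fin
open import Data.List using (List; []; _∷_; _++_; map; concatMap; foldl; foldr; length; allFin; lookup)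
import Data.List.Properties as List
open import Data.List.Membership.Propositional using (_∈_; find; lose)
open import Data.List.Membership.Propositional.Properties using (∈-concatMap⁺; ∈-concatMap⁻; ∈-++⁺ˡ; ∈-++⁺ʳ; ∈-++⁻; ∈-map⁺; ∈-map⁻; ∈-allFin; ∈-lookup)
open import Data.List.Relation.Unary.Any using (here; there; index)
open import Data.Maybe using (Maybe; just; nothing; zipWith)
open import Data.Product using (Σ; _×_; ∃; ∃₂; _,_; proj₁; proj₂)
open import Data.Sum using (_⊎_; inj₁; inj₂; isInj₁; isInj₂)
import Data.Sum.Properties as Sum
open import Function using (_∘_)
open import Function.Bundles using (_↔_; Inverse; mk↔ₛ′)
open import Function.Properties.Inverse using (↔-refl)
open import Data.List.Membership.DecPropositional ℕ._≟_ using (_∈?_)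
open import Relation.Nullary using (Dec; yes; no; contradiction; _×-dec_; _⊎-dec_)
open import Relation.Binary using (DecidableEquality)
open import Relation.Binary.PropositionalEquality using (_≡_; _≢_; refl; sym; trans; cong; cong₂; subst; module ≡-Reasoning)

module _ {A B : Set} (f : A → List B) where
  ∈-concatMap-intro : ∀ {x xs y} → x ∈ xs → y ∈ f x → y ∈ concatMap f xs
  ∈-concatMap-intro x∈xs y∈fx = ∈-concatMap⁺ f (lose x∈xs y∈fx)

  ∈-concatMap-elim : ∀ {xs y} → y ∈ concatMap f xs → ∃ λ x → x ∈ xs × y ∈ f x
  ∈-concatMap-elim = find ∘ ∈-concatMap⁻ f

  length-concatMap-≤ : ∀ xs {n} → (∀ {x} → x ∈ xs → length (f x) ≤ n) → length (concatMap f xs) ≤ length xs * n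
  length-concatMap-≤ []       bound = z≤n
  length-concatMap-≤ (x ∷ xs) bound = ℕ.≤-trans (ℕ.≤-reflexive (List.length-++ (f x)))
    (ℕ.+-mono-≤ (bound (here refl)) (length-concatMap-≤ xs (bound ∘ there)))

∃∈↔Fin : ∀ {T : Set} (xs : List T) → (∃ λ x → x ∈ xs) ↔ Fin (length xs)
∃∈↔Fin xs = mk↔ₛ′ (λ (_ , x∈) → index x∈) (λ i → lookup xs i , ∈-lookup i) (index-∈-lookup xs) (λ (_ , x∈) → lookup-index x∈)
  where
    index-∈-lookup : ∀ xs i → index (∈-lookup {xs = xs} i) ≡ i
    index-∈-lookup (_ ∷ _)  zero    = refl
    index-∈-lookup (_ ∷ xs) (suc i) = cong suc (index-∈-lookup xs i)

    lookup-index : ∀ {x xs} (x∈ : x ∈ xs) → (lookup xs (index x∈) , ∈-lookup (index x∈)) ≡ (x , x∈)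
    lookup-index (here refl) = refl
    lookup-index (there x∈)  = cong (λ (y , y∈) → y , there y∈) (lookup-index x∈)

module HeytingFacts (𝓗 : CCDHeyting) where
  open CCDHeyting 𝓗 renaming (_≤_ to _⊑_)

  ≤-reflexive : ∀ {x y} → x ≡ y → x ⊑ y
  ≤-reflexive refl = ≤-refl

  ≥-reflexive : ∀ {x y} → x ≡ y → y ⊑ x
  ≥-reflexive refl = ≤-refl

  infixr 1 _⊙_
  _⊙_ : ∀ {x y z} → x ⊑ y → y ⊑ z → x ⊑ z
  _⊙_ = ≤-trans

  π₁ : ∀ {x y} → x ∧ y ⊑ x
  π₁ = ∧-lbˡ _ _

  π₂ : ∀ {x y} → x ∧ y ⊑ y
  π₂ = ∧-lbʳ _ _

  ⟨_,_⟩ : ∀ {x y z} → z ⊑ x → z ⊑ y → z ⊑ x ∧ y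
  ⟨_,_⟩ = ∧-glb

  ≤⊤ : ∀ {z} → z ⊑ ⊤
  ≤⊤ = ⊤-max _

  ⇒-apply : ∀ {x y z} → z ⊑ x ⇒ y → z ⊑ x → z ⊑ y
  ⇒-apply p q = ⟨ p , q ⟩ ⊙ ⇒-elim ≤-refl

  ⇒-mono : ∀ {x x′ y y′} → x′ ⊑ x → y ⊑ y′ → x ⇒ y ⊑ x′ ⇒ y′
  ⇒-mono p q = ⇒-intro (⇒-apply π₁ (π₂ ⊙ p) ⊙ q)

  ⊤⇒-elim : ∀ {x y} → ⊤ ⊑ x → x ⇒ y ⊑ y
  ⊤⇒-elim p = ⇒-apply ≤-refl (≤⊤ ⊙ p)

  ⊤⇒-identity : ∀ y → (⊤ ⇒ y) ≡ y
  ⊤⇒-identity y = ≤-antisym (⊤⇒-elim ≤-refl) (⇒-intro π₁)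

  ⋀-mono : ∀ {I : Set} {f g : I → H} → (∀ i → f i ⊑ g i) → ⋀ f ⊑ ⋀ g
  ⋀-mono {f = f} {g} f≤g = ⋀-glb g (λ i → ⋀-lb f i ⊙ f≤g i)

  ⋀-cong : ∀ {I : Set} {f g : I → H} → (∀ i → f i ≡ g i) → ⋀ f ≡ ⋀ g
  ⋀-cong f≡g = ≤-antisym (⋀-mono (λ i → ≤-reflexive (f≡g i))) (⋀-mono (λ i → ≥-reflexive (f≡g i)))

  -- Subsethood degree.  Definitionally I⁽¹⁾[ f ] x = f ≼ (λ a → I a x) and I⁽⁰⁾[ u ] a = u ≼ I a.
  infix 8 _≼_
  _≼_ : {T : Set} → (T → H) → (T → H) → H
  f ≼ g = ⋀ (λ t → f t ⇒ g t)

  module _ {T : Set} where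
    ≼-intro : ∀ {f g : T → H} {z} → (∀ t → z ∧ f t ⊑ g t) → z ⊑ f ≼ g
    ≼-intro p = ⋀-glb _ (λ t → ⇒-intro (p t))

    ≼-elim : ∀ {f g : T → H} {z} t → z ⊑ f ≼ g → z ⊑ f t → z ⊑ g t
    ≼-elim {f} {g} t p q = ⇒-apply (p ⊙ ⋀-lb (λ t → f t ⇒ g t) t) q

    ≼-trans : ∀ {f g h : T → H} {z} → z ⊑ f ≼ g → z ⊑ g ≼ h → z ⊑ f ≼ h
    ≼-trans p q = ≼-intro (λ t → ≼-elim t (π₁ ⊙ q) (≼-elim t (π₁ ⊙ p) π₂))

    ≼-∧ : ∀ {f g h : T → H} {z} → z ⊑ f ≼ g → z ⊑ f ≼ h → z ⊑ f ≼ (λ t → g t ∧ h t)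
    ≼-∧ p q = ≼-intro (λ t → ⟨ ≼-elim t (π₁ ⊙ p) π₂ , ≼-elim t (π₁ ⊙ q) π₂ ⟩)

    ≼-refl : ∀ {f : T → H} {z} → z ⊑ f ≼ f
    ≼-refl = ≼-intro (λ t → π₂)

    ≤⇒≼ : ∀ {f g : T → H} → (∀ t → f t ⊑ g t) → ∀ {z} → z ⊑ f ≼ g
    ≤⇒≼ f≤g = ≼-intro (λ t → π₂ ⊙ f≤g t)

    ≼-mono : ∀ {f f′ g g′ : T → H} → (∀ t → f′ t ⊑ f t) → (∀ t → g t ⊑ g′ t) → f ≼ g ⊑ f′ ≼ g′
    ≼-mono f′≤f g≤g′ = ≼-intro (λ t → ≼-elim t π₁ (π₂ ⊙ f′≤f t) ⊙ g≤g′ t)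

  ≼-cong : ∀ {T : Set} {f g h : T → H} → (∀ t → g t ≡ h t) → f ≼ g ≡ f ≼ h
  ≼-cong {f = f} g≡h = ⋀-cong (λ t → cong (f t ⇒_) (g≡h t))

  ≼-∧-distrib : ∀ {T : Set} (f g h : T → H) → (f ≼ g ∧ f ≼ h) ≡ f ≼ (λ t → g t ∧ h t)
  ≼-∧-distrib f g h = ≤-antisym (≼-∧ π₁ π₂) ⟨ ≼-mono (λ _ → ≤-refl) (λ _ → π₁) , ≼-mono (λ _ → ≤-refl) (λ _ → π₂) ⟩

  guard : {P : Set} → Dec P → H → H
  guard (yes _) h = h
  guard (no _)  _ = ⊤

  guard-yes : ∀ {P : Set} (P? : Dec P) {h} → P → guard P? h ≡ h
  guard-yes (yes _) p = refl
  guard-yes (no ¬p) p = contradiction p ¬p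

  guard-intro : ∀ {P : Set} (P? : Dec P) {z h} → (P → z ⊑ h) → z ⊑ guard P? h
  guard-intro (yes p) z≤h = z≤h p
  guard-intro (no _)  z≤h = ≤⊤

  guard-⊤-or : ∀ {P : Set} (P? : Dec P) {h} → ⊤ ⊑ guard P? h ⊎ P
  guard-⊤-or (yes p) = inj₂ p
  guard-⊤-or (no _)  = inj₁ ≤-refl

  guard-≤ : ∀ {P Q : Set} (P? : Dec P) (Q? : Dec Q) {u v} → (Q → P) → (Q → u ⊑ v) → guard P? u ⊑ guard Q? v
  guard-≤ P? Q? Q⇒P u≤v = guard-intro Q? (λ q → ≤-reflexive (guard-yes P? (Q⇒P q)) ⊙ u≤v q)

module Polarity (𝓗 : CCDHeyting) {A X : Set} (I : A → X → CCDHeyting.H 𝓗) where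
  open CCDHeyting 𝓗 renaming (_≤_ to _⊑_)
  open HeytingFacts 𝓗

  infix 9 _↑ _↓
  _↑ : (A → H) → X → H
  (f ↑) x = f ≼ (λ a → I a x)

  _↓ : (X → H) → A → H
  (u ↓) a = u ≼ I a

  ↑↓-extensive : ∀ f a → f a ⊑ (f ↑ ↓) a
  ↑↓-extensive f a = ≼-intro (λ x → ≼-elim a π₂ π₁)

  ↓↑-extensive : ∀ u x → u x ⊑ (u ↓ ↑) x
  ↓↑-extensive u x = ≼-intro (λ a → ≼-elim x π₂ π₁)

  ↑-antitone-≼ : ∀ f g {z} → z ⊑ f ≼ g → z ⊑ g ↑ ≼ f ↑
  ↑-antitone-≼ f g p = ≼-intro (λ x → ≼-intro (λ a → ≼-elim a (π₁ ⊙ π₂) (≼-elim a (π₁ ⊙ π₁ ⊙ p) π₂)))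

  ↓-antitone-≼ : ∀ u v {z} → z ⊑ u ≼ v → z ⊑ v ↓ ≼ u ↓
  ↓-antitone-≼ u v p = ≼-intro (λ a → ≼-intro (λ x → ≼-elim x (π₁ ⊙ π₂) (≼-elim x (π₁ ⊙ π₁ ⊙ p) π₂)))

  ↑-antitone : ∀ {f g} → (∀ a → f a ⊑ g a) → ∀ x → (g ↑) x ⊑ (f ↑) x
  ↑-antitone {f} {g} f≤g x = ⟨ ≤⇒≼ f≤g , ≤-refl ⟩ ⊙ ≼-elim x (π₁ ⊙ ↑-antitone-≼ f g ≤-refl) π₂

  ↓-antitone : ∀ {u v} → (∀ x → u x ⊑ v x) → ∀ a → (v ↓) a ⊑ (u ↓) a
  ↓-antitone {u} {v} u≤v a = ⟨ ≤⇒≼ u≤v , ≤-refl ⟩ ⊙ ≼-elim a (π₁ ⊙ ↓-antitone-≼ u v ≤-refl) π₂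

  -- Only the nontrivial inequality of Galois-stability; the other one is ↑↓-extensive.
  IsExtent : (A → H) → Set
  IsExtent f = ∀ a → (f ↑ ↓) a ⊑ f a

  IsIntent : (X → H) → Set
  IsIntent u = ∀ x → (u ↓ ↑) x ⊑ u x

  IsExtent⇒stable : ∀ {f} → IsExtent f → ∀ a → (f ↑ ↓) a ≡ f a
  IsExtent⇒stable {f} s a = ≤-antisym (s a) (↑↓-extensive f a)

  IsIntent⇒stable : ∀ {u} → IsIntent u → ∀ x → (u ↓ ↑) x ≡ u x
  IsIntent⇒stable {u} s x = ≤-antisym (s x) (↓↑-extensive u x)

  stable⇒IsExtent : ∀ {f} → (∀ a → (f ↑ ↓) a ≡ f a) → IsExtent f
  stable⇒IsExtent s a = ≤-reflexive (s a)

  stable⇒IsIntent : ∀ {u} → (∀ x → (u ↓ ↑) x ≡ u x) → IsIntent u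
  stable⇒IsIntent s x = ≤-reflexive (s x)

  ↓-isExtent : ∀ u → IsExtent (u ↓)
  ↓-isExtent u = ↓-antitone (↓↑-extensive u)

  ↑-isIntent : ∀ f → IsIntent (f ↑)
  ↑-isIntent f = ↑-antitone (↑↓-extensive f)

  ↓↑↓ : ∀ u a → (u ↓ ↑ ↓) a ≡ (u ↓) a
  ↓↑↓ u = IsExtent⇒stable (↓-isExtent u)

  IsExtent-resp : ∀ {f g} → (∀ a → f a ≡ g a) → IsExtent f → IsExtent g
  IsExtent-resp f≡g s a = ↓-antitone (↑-antitone (λ a′ → ≥-reflexive (f≡g a′))) a ⊙ s a ⊙ ≤-reflexive (f≡g a)

  IsIntent-resp : ∀ {u v} → (∀ x → u x ≡ v x) → IsIntent u → IsIntent v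
  IsIntent-resp u≡v s x = ↑-antitone (↓-antitone (λ x′ → ≥-reflexive (u≡v x′))) x ⊙ s x ⊙ ≤-reflexive (u≡v x)

  IsExtent-⇒ : ∀ {f} α → IsExtent f → IsExtent (λ a → α ⇒ f a)
  IsExtent-⇒ {f} α s a = ⇒-intro (⇒-extent ⊙ s a)
    where
      ⇒-extent : ((λ a → α ⇒ f a) ↑ ↓) a ∧ α ⊑ (f ↑ ↓) a
      ⇒-extent = ≼-intro (λ x → ≼-elim x (π₁ ⊙ π₁) (≼-intro (λ a′ → ≼-elim a′ (π₁ ⊙ π₂) (⇒-apply π₂ (π₁ ⊙ π₁ ⊙ π₂)))))

  IsIntent-⇒ : ∀ {u} α → IsIntent u → IsIntent (λ x → α ⇒ u x)
  IsIntent-⇒ {u} α s x = ⇒-intro (⇒-intent ⊙ s x)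
    where
      ⇒-intent : ((λ x → α ⇒ u x) ↓ ↑) x ∧ α ⊑ (u ↓ ↑) x
      ⇒-intent = ≼-intro (λ a → ≼-elim a (π₁ ⊙ π₁) (≼-intro (λ x′ → ≼-elim x′ (π₁ ⊙ π₂) (⇒-apply π₂ (π₁ ⊙ π₁ ⊙ π₂)))))

  IsExtent-⋀ : ∀ {K : Set} (f : K → A → H) → (∀ k → IsExtent (f k)) → IsExtent (λ a → ⋀ (λ k → f k a))
  IsExtent-⋀ f s a = ⋀-glb _ (λ k → ↓-antitone (↑-antitone (λ a′ → ⋀-lb (λ k → f k a′) k)) a ⊙ s k a)

  IsIntent-⋀ : ∀ {K : Set} (u : K → X → H) → (∀ k → IsIntent (u k)) → IsIntent (λ x → ⋀ (λ k → u k x))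
  IsIntent-⋀ u s x = ⋀-glb _ (λ k → ↑-antitone (↓-antitone (λ x′ → ⋀-lb (λ k → u k x′) k)) x ⊙ s k x)

  IsExtent-∧ : ∀ {f g} → IsExtent f → IsExtent g → IsExtent (λ a → f a ∧ g a)
  IsExtent-∧ sf sg a = ⟨ ↓-antitone (↑-antitone (λ _ → π₁)) a ⊙ sf a , ↓-antitone (↑-antitone (λ _ → π₂)) a ⊙ sg a ⟩

  IsIntent-∧ : ∀ {u v} → IsIntent u → IsIntent v → IsIntent (λ x → u x ∧ v x)
  IsIntent-∧ su sv x = ⟨ ↑-antitone (↓-antitone (λ _ → π₁)) x ⊙ su x , ↑-antitone (↓-antitone (λ _ → π₂)) x ⊙ sv x ⟩

  IsExtent-byColumns : ∀ {f} → (∀ a → ⊤ ⊑ f a ⊎ ∃ λ x → (∀ a′ → f a′ ⊑ I a′ x) × I a x ⊑ f a) → IsExtent f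
  IsExtent-byColumns {f} cover a with cover a
  ... | inj₁ ⊤≤fa = ≤⊤ ⊙ ⊤≤fa
  ... | inj₂ (x , f≤Ix , Iax≤fa) = ≼-elim x ≤-refl (≤⊤ ⊙ ≼-intro (λ a′ → π₂ ⊙ f≤Ix a′)) ⊙ Iax≤fa

  IsIntent-byRows : ∀ {u} → (∀ x → ⊤ ⊑ u x ⊎ ∃ λ a → (∀ x′ → u x′ ⊑ I a x′) × I a x ⊑ u x) → IsIntent u
  IsIntent-byRows {u} cover x with cover x
  ... | inj₁ ⊤≤ux = ≤⊤ ⊙ ⊤≤ux
  ... | inj₂ (a , u≤Ia , Iax≤ux) = ≼-elim a ≤-refl (≤⊤ ⊙ ≼-intro (λ x′ → π₂ ⊙ u≤Ia x′)) ⊙ Iax≤ux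

  ≼↓⇒≼↑ : ∀ f u {z} → z ⊑ f ≼ u ↓ → z ⊑ u ≼ f ↑
  ≼↓⇒≼↑ f u p = ≼-intro (λ x → ≼-intro (λ a → ≼-elim x (≼-elim a (π₁ ⊙ π₁ ⊙ p) π₂) (π₁ ⊙ π₂)))

  ≼↑⇒≼↓ : ∀ f u {z} → z ⊑ u ≼ f ↑ → z ⊑ f ≼ u ↓
  ≼↑⇒≼↓ f u p = ≼-intro (λ a → ≼-intro (λ x → ≼-elim a (≼-elim x (π₁ ⊙ π₁ ⊙ p) π₂) (π₁ ⊙ π₂)))

  ↓≼⇒↑≼ : ∀ {f u z} → IsIntent u → z ⊑ u ↓ ≼ f → z ⊑ f ↑ ≼ u
  ↓≼⇒↑≼ {f} {u} su p = ≼-trans (≼↓⇒≼↑ (u ↓) (f ↑) (≼-trans p (≤⇒≼ (↑↓-extensive f)))) (≤⇒≼ su)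

  ↑≼⇒↓≼ : ∀ {f u z} → IsExtent f → z ⊑ f ↑ ≼ u → z ⊑ u ↓ ≼ f
  ↑≼⇒↓≼ {f} {u} sf p = ≼-trans (≼↑⇒≼↓ (u ↓) (f ↑) (≼-trans p (≤⇒≼ (↓↑-extensive u)))) (≤⇒≼ sf)

module InterpretationFacts (𝓗 : CCDHeyting) (nG nF : ℕ) where
  open CCDHeyting 𝓗 renaming (_≤_ to _⊑_)
  open HeytingFacts 𝓗
  open LE-FALC 𝓗 nG nF hiding (A; X; val)

  ⟨/⟩-≼ : ∀ {W : Set} α (w : W) (h : W → H) → ⟨ α / w ⟩ ≼ h ≡ (α ⇒ h w)
  ⟨/⟩-≼ α w h = ≤-antisym
    (⋀-lb _ w ⊙ ⇒-mono (⋁-ub (λ _ → α) refl) ≤-refl)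
    (⋀-glb _ (λ v → ⇒-intro (⟨ π₂ , π₁ ⟩ ⊙ at v)))
    where
      at : ∀ v → ⟨ α / w ⟩ v ∧ (α ⇒ h w) ⊑ h v
      at v = ⇒-apply (π₁ ⊙ ⋁-lub (λ (_ : v ≡ w) → α) {z = (α ⇒ h w) ⇒ h v} (λ { refl → ⇒-intro (⇒-apply π₂ π₁) })) π₂

  module Model (M : Interpretation) where
    open Interpretation M hiding (_↑; _↓)
    open Polarity 𝓗 I public
    module R□-Polarity (g : Fin nG) = Polarity 𝓗 (R□ g)
    module R◇-Polarity (d : Fin nF) = Polarity 𝓗 (R◇ d)

    -- R⁽⁰⁾[ u ] is the meet over x of R⁽⁰⁾[ {u x / x} ], each Galois-stable by I-compatibility.
    R□⁽⁰⁾-isExtent : ∀ g u → IsExtent (R□ g ⁽⁰⁾[ u ])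
    R□⁽⁰⁾-isExtent g u = IsExtent-⋀ (λ x a → u x ⇒ R□ g a x)
      (λ x → IsExtent-resp (λ a → ⟨/⟩-≼ (u x) x (R□ g a)) (stable⇒IsExtent (R□-compat₀ g x (u x))))

    R□⁽¹⁾-isIntent : ∀ g f → IsIntent (R□ g ⁽¹⁾[ f ])
    R□⁽¹⁾-isIntent g f = IsIntent-⋀ (λ a x → f a ⇒ R□ g a x)
      (λ a → IsIntent-resp (λ x → ⟨/⟩-≼ (f a) a (λ a′ → R□ g a′ x)) (stable⇒IsIntent (R□-compat₁ g a (f a))))

    R◇⁽⁰⁾-isIntent : ∀ d f → IsIntent (R◇ d ⁽⁰⁾[ f ])
    R◇⁽⁰⁾-isIntent d f = IsIntent-⋀ (λ a x → f a ⇒ R◇ d x a)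
      (λ a → IsIntent-resp (λ x → ⟨/⟩-≼ (f a) a (R◇ d x)) (stable⇒IsIntent (R◇-compat₀ d a (f a))))

    R◇⁽¹⁾-isExtent : ∀ d u → IsExtent (R◇ d ⁽¹⁾[ u ])
    R◇⁽¹⁾-isExtent d u = IsExtent-⋀ (λ x a → u x ⇒ R◇ d x a)
      (λ x → IsExtent-resp (λ a → ⟨/⟩-≼ (u x) x (λ x′ → R◇ d x′ a)) (stable⇒IsExtent (R◇-compat₁ d x (u x))))

    isFormalConcept : ∀ C → (∀ x → (ext C ↑) x ≡ int C x) × (∀ a → (int C ↓) a ≡ ext C a)
    ext-isExtent : ∀ C → IsExtent (ext C)
    int-isIntent : ∀ C → IsIntent (int C)

    isFormalConcept (prim p)  = prim-up p , prim-down p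
    isFormalConcept (C ⊓ D)   = (λ _ → refl) , IsExtent⇒stable (IsExtent-∧ (ext-isExtent C) (ext-isExtent D))
    isFormalConcept (C ⊔ D)   = IsIntent⇒stable (IsIntent-∧ (int-isIntent C) (int-isIntent D)) , (λ _ → refl)
    isFormalConcept ([ g ] C) = (λ _ → refl) , IsExtent⇒stable (R□⁽⁰⁾-isExtent g (int C))
    isFormalConcept (⟨ d ⟩ C) = IsIntent⇒stable (R◇⁽⁰⁾-isIntent d (ext C)) , (λ _ → refl)

    ext-isExtent C = IsExtent-resp (proj₂ (isFormalConcept C)) (↓-isExtent (int C))

    int-isIntent C = IsIntent-resp (proj₁ (isFormalConcept C)) (↑-isIntent (ext C))

    ext-⊔-≼ : ∀ C D {e} → IsExtent e → ext (C ⊔ D) ≼ e ≡ (ext C ≼ e ∧ ext D ≼ e)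
    ext-⊔-≼ C D {e} se = ≤-antisym
      ⟨ ≼-mono (λ a → ≥-reflexive (proj₂ (isFormalConcept C) a) ⊙ ↓-antitone (λ _ → π₁) a) (λ _ → ≤-refl)
      , ≼-mono (λ a → ≥-reflexive (proj₂ (isFormalConcept D) a) ⊙ ↓-antitone (λ _ → π₂) a) (λ _ → ≤-refl) ⟩
      (↑≼⇒↓≼ se (≼-∧ (intent C π₁) (intent D π₂)))
      where
        intent : ∀ E {z} → z ⊑ ext E ≼ e → z ⊑ e ↑ ≼ int E
        intent E p = ↓≼⇒↑≼ (int-isIntent E) (≼-trans (≤⇒≼ (λ a → ≤-reflexive (proj₂ (isFormalConcept E) a))) p)

    -- On extents, ◆ᵉ g is left adjoint to □ᵉ g and ■ᵉ d is right adjoint to ◇ᵉ d.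
    □ᵉ ◆ᵉ : Fin nG → (A → H) → (A → H)
    □ᵉ g e = R□ g ⁽⁰⁾[ e ↑ ]
    ◆ᵉ g e = (R□ g ⁽¹⁾[ e ]) ↓

    ◇ᵉ ■ᵉ : Fin nF → (A → H) → (A → H)
    ◇ᵉ d e = (R◇ d ⁽⁰⁾[ e ]) ↓
    ■ᵉ d e = R◇ d ⁽¹⁾[ e ↑ ]

    □ᵉ-isExtent : ∀ g e → IsExtent (□ᵉ g e)
    □ᵉ-isExtent g e = R□⁽⁰⁾-isExtent g (e ↑)

    ■ᵉ-isExtent : ∀ d e → IsExtent (■ᵉ d e)
    ■ᵉ-isExtent d e = R◇⁽¹⁾-isExtent d (e ↑)

    ≼□⇒◆≼ : ∀ g {x y z} → IsExtent y → z ⊑ x ≼ □ᵉ g y → z ⊑ ◆ᵉ g x ≼ y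
    ≼□⇒◆≼ g {x} {y} sy p = ↑≼⇒↓≼ sy (R□-Polarity.≼↓⇒≼↑ g x (y ↑) p)

    ◆≼⇒≼□ : ∀ g {x y z} → IsExtent y → z ⊑ ◆ᵉ g x ≼ y → z ⊑ x ≼ □ᵉ g y
    ◆≼⇒≼□ g {x} {y} sy p = R□-Polarity.≼↑⇒≼↓ g x (y ↑) (↓≼⇒↑≼ (R□⁽¹⁾-isIntent g x) p)

    ◇≼⇒≼■ : ∀ d {x y z} → IsExtent y → z ⊑ ◇ᵉ d x ≼ y → z ⊑ x ≼ ■ᵉ d y
    ◇≼⇒≼■ d {x} {y} sy p = R◇-Polarity.≼↓⇒≼↑ d (y ↑) x (↓≼⇒↑≼ (R◇⁽⁰⁾-isIntent d x) p)

    ≼■⇒◇≼ : ∀ d {x y z} → IsExtent y → z ⊑ x ≼ ■ᵉ d y → z ⊑ ◇ᵉ d x ≼ y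
    ≼■⇒◇≼ d {x} {y} sy p = ↑≼⇒↓≼ sy (R◇-Polarity.≼↑⇒≼↓ d (y ↑) x p)

    ≼□-mono : ∀ g {x e y z} → z ⊑ x ≼ □ᵉ g e → z ⊑ e ≼ y → z ⊑ x ≼ □ᵉ g y
    ≼□-mono g {x} {e} {y} p q = ≼-trans p (R□-Polarity.↓-antitone-≼ g (y ↑) (e ↑) (↑-antitone-≼ e y q))

    ◇≼-mono : ∀ d {x e y z} → z ⊑ ◇ᵉ d e ≼ y → z ⊑ x ≼ e → z ⊑ ◇ᵉ d x ≼ y
    ◇≼-mono d {x} {e} p q = ≼-trans (↓-antitone-≼ _ _ (R◇-Polarity.↓-antitone-≼ d x e q)) p

    □ᵉ-ext : ∀ g C a → □ᵉ g (ext C) a ≡ ext ([ g ] C) a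
    □ᵉ-ext g C a = ⋀-cong (λ x → cong (λ h → h ⇒ R□ g a x) (proj₁ (isFormalConcept C) x))

    objExtent : A → (A → H)
    objExtent b = I b ↓

    featExtent : X → (A → H)
    featExtent y a = I a y

    featExtent-isExtent : ∀ y → IsExtent (featExtent y)
    featExtent-isExtent y a = ≼-elim y ≤-refl (≤⊤ ⊙ ≼-intro (λ _ → π₂))

    objExtent-≼ : ∀ {e} → IsExtent e → ∀ b → objExtent b ≼ e ≡ e b
    objExtent-≼ {e} se b = ≤-antisym
      (≼-elim b ≤-refl (≤⊤ ⊙ ≼-intro (λ _ → π₂)))
      (≼-intro (λ a → ≼-intro (λ x → ≼-elim x (π₁ ⊙ π₂) (≼-elim b π₂ (π₁ ⊙ π₁))) ⊙ se a))

    R□-row-isIntent : ∀ g b → IsIntent (R□ g b)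
    R□-row-isIntent g b = IsIntent-resp (λ x → trans (⟨/⟩-≼ ⊤ b (λ a → R□ g a x)) (⊤⇒-identity _))
                                         (R□⁽¹⁾-isIntent g ⟨ ⊤ / b ⟩)

    R◇-column-isExtent : ∀ d y → IsExtent (R◇ d y)
    R◇-column-isExtent d y = IsExtent-resp (λ a → trans (⟨/⟩-≼ ⊤ y (λ x → R◇ d x a)) (⊤⇒-identity _))
                                            (R◇⁽¹⁾-isExtent d ⟨ ⊤ / y ⟩)

    □ᵉ-featExtent : ∀ g b y → □ᵉ g (featExtent y) b ≡ R□ g b y
    □ᵉ-featExtent g b y = ≤-antisym
      (⇒-apply (⋀-lb _ y) (≤⊤ ⊙ ≼-intro (λ _ → π₂)))
      (⋀-glb _ (λ x → ⇒-intro (through-row x ⊙ R□-row-isIntent g b x)))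
      where
        through-row : ∀ x → R□ g b y ∧ (featExtent y ↑) x ⊑ (R□ g b ↓ ↑) x
        through-row x = ≼-intro (λ a → ≼-elim a (π₁ ⊙ π₂) (≼-elim y π₂ (π₁ ⊙ π₁)))

    ◇ᵉ-objExtent : ∀ d b y → ◇ᵉ d (objExtent b) ≼ featExtent y ≡ R◇ d y b
    ◇ᵉ-objExtent d b y = trans (IsIntent⇒stable (R◇⁽⁰⁾-isIntent d (objExtent b)) y)
                               (objExtent-≼ (R◇-column-isExtent d y) b)

module Paths (nG nF : ℕ) where
  Modality : Set
  Modality = Fin nG ⊎ Fin nF

  Path : Set
  Path = List Modality

  _≟ₚ_ : DecidableEquality Path
  _≟ₚ_ = List.≡-dec (Sum.≡-dec Fin._≟_ Fin._≟_)

  module Strip {T : Set} (emb : T → Modality) (match : Modality → Maybe T)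
               (match-emb : ∀ t → match (emb t) ≡ just t)
               (match-sound : ∀ {m t} → match m ≡ just t → emb t ≡ m) where

    strip : Path → Path → Maybe (List T)
    strip r q with q ≟ₚ r
    ... | yes _ = just []
    strip r []      | no _ = nothing
    strip r (m ∷ q) | no _ = zipWith _∷_ (match m) (strip r q)

    strip-sound : ∀ r q {ts} → strip r q ≡ just ts → q ≡ map emb ts ++ r
    strip-sound r q e with q ≟ₚ r
    strip-sound r q refl | yes q≡r = q≡r
    strip-sound r (m ∷ q) e | no _ with match m in m≡ | strip r q in s≡
    strip-sound r (m ∷ q) refl | no _ | just t | just ts = cong₂ _∷_ (sym (match-sound m≡)) (strip-sound r q s≡)

    strip-complete : ∀ r ts → strip r (map emb ts ++ r) ≡ just ts
    strip-complete r [] with r ≟ₚ r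
    ... | yes _   = refl
    ... | no r≢r = contradiction refl r≢r
    strip-complete r (t ∷ ts) with (emb t ∷ map emb ts ++ r) ≟ₚ r
    ... | yes e = contradiction (List.++-identityˡ-unique (emb t ∷ map emb ts) (sym e)) (λ ())
    ... | no _ rewrite match-emb t | strip-complete r ts = refl

  -- Values attached to the paths of Base are moved along the tree of paths:
  -- towards the root across "up" modalities (by ascend) and away from it across
  -- "down" modalities (by descend).  After a down-move no up-move is possible, so
  -- every route climbs to a turning block and then descends; hence the result has
  -- at most |Base| · |Blocks|² elements.
  module Transport {U D : Set} (orientation : (U ⊎ D) ↔ Modality)
                   {V : Set} (ascend : U → V → V) (descend : D → V → V)
                   (Blocks : List Path) (Blocks-tail : ∀ {m p} → m ∷ p ∈ Blocks → p ∈ Blocks)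
                   (Base : List (Path × V)) where
    open Inverse orientation using (to; from; strictlyInverseˡ; strictlyInverseʳ)

    up : U → Modality
    up u = to (inj₁ u)

    down : D → Modality
    down t = to (inj₂ t)

    up≢down : ∀ {u t} → up u ≢ down t
    up≢down {u} {t} e with trans (sym (strictlyInverseʳ (inj₁ u))) (trans (cong from e) (strictlyInverseʳ (inj₂ t)))
    ... | ()

    match-up : ∀ {m u} → isInj₁ (from m) ≡ just u → up u ≡ m
    match-up {m} e with from m in fm
    match-up {m} refl | inj₁ u = trans (cong to (sym fm)) (strictlyInverseˡ m)

    match-down : ∀ {m t} → isInj₂ (from m) ≡ just t → down t ≡ m
    match-down {m} e with from m in fm
    match-down {m} refl | inj₂ t = trans (cong to (sym fm)) (strictlyInverseˡ m)

    module Ascent  = Strip up   (isInj₁ ∘ from) (λ u → cong isInj₁ (strictlyInverseʳ (inj₁ u))) match-up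
    module Descent = Strip down (isInj₂ ∘ from) (λ t → cong isInj₂ (strictlyInverseʳ (inj₂ t))) match-down

    ascendAll : List U → V → V
    ascendAll us x = foldl (λ y u → ascend u y) x us

    descendAll : List D → V → V
    descendAll ts x = foldr descend x ts

    arrivals : Path → V → Maybe (List U) → Maybe (List D) → List (Path × V)
    arrivals p e (just us) (just ts) = (p , descendAll ts (ascendAll us e)) ∷ []
    arrivals p e _         _         = []

    via : Path → V → Path → Path → List (Path × V)
    via q e r p = arrivals p e (Ascent.strip r q) (Descent.strip r p)

    routesFrom : Path × V → List (Path × V)
    routesFrom (q , e) = concatMap (λ r → concatMap (via q e r) Blocks) Blocks

    record Route (p : Path) (x : V) : Set where
      field
        source : Path
        value  : V
        source∈ : (source , value) ∈ Base
        turn   : Path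
        turn∈  : turn ∈ Blocks
        ups    : List U
        downs  : List D
        source≡ : source ≡ map up ups ++ turn
        path≡  : p ≡ map down downs ++ turn
        value≡ : x ≡ descendAll downs (ascendAll ups value)
        path∈  : p ∈ Blocks

    arrivals-elim : ∀ {p e mu mt p′ x} → (p′ , x) ∈ arrivals p e mu mt →
                    ∃₂ λ us ts → mu ≡ just us × mt ≡ just ts × p′ ≡ p × x ≡ descendAll ts (ascendAll us e)
    arrivals-elim {mu = just us} {just ts} (here refl) = us , ts , refl , refl , refl , refl

    -- Abstract: unfolding reachable makes with-abstractions over it blow up.
    abstract
      reachable : List (Path × V)
      reachable = concatMap routesFrom Base

      reachable-intro : ∀ {q e r us p ts} → (q , e) ∈ Base → r ∈ Blocks → p ∈ Blocks →
                        q ≡ map up us ++ r → p ≡ map down ts ++ r → (p , descendAll ts (ascendAll us e)) ∈ reachable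
      reachable-intro {q} {e} {r} {us} {p} {ts} qe∈ r∈ p∈ refl refl =
        ∈-concatMap-intro routesFrom qe∈ (∈-concatMap-intro (λ r → concatMap (via q e r) Blocks) r∈ (∈-concatMap-intro (via q e r) p∈ arrived))
        where
          arrived : (p , descendAll ts (ascendAll us e)) ∈ via q e r p
          arrived rewrite Ascent.strip-complete r us | Descent.strip-complete r ts = here refl

      reachable-route : ∀ {p x} → (p , x) ∈ reachable → Route p x
      reachable-route h with ∈-concatMap-elim routesFrom h
      ... | (q , e) , qe∈ , h₁ with ∈-concatMap-elim (λ r → concatMap (via q e r) Blocks) h₁
      ... | r , r∈ , h₂ with ∈-concatMap-elim (via q e r) h₂
      ... | p , p∈ , h₃ with arrivals-elim h₃
      ... | us , ts , sq , sp , refl , refl = record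
        { source = q ; value = e ; source∈ = qe∈ ; turn = r ; turn∈ = r∈ ; ups = us ; downs = ts
        ; source≡ = Ascent.strip-sound r q sq ; path≡ = Descent.strip-sound r p sp ; value≡ = refl ; path∈ = p∈ }

      length-reachable : length reachable ≤ length Base * (length Blocks * length Blocks)
      length-reachable = length-concatMap-≤ routesFrom Base (λ {qe} _ → routes-≤ qe)
        where
          arrivals-≤1 : ∀ p e mu mt → length (arrivals p e mu mt) ≤ 1
          arrivals-≤1 p e (just _) (just _) = s≤s z≤n
          arrivals-≤1 p e (just _) nothing  = z≤n
          arrivals-≤1 p e nothing  _        = z≤n

          routes-≤ : ∀ qe → length (routesFrom qe) ≤ length Blocks * length Blocks
          routes-≤ (q , e) = length-concatMap-≤ (λ r → concatMap (via q e r) Blocks) Blocks (λ {r} _ →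
            ℕ.≤-trans (length-concatMap-≤ (via q e r) Blocks (λ {p} _ → arrivals-≤1 p e (Ascent.strip r q) (Descent.strip r p)))
                      (ℕ.≤-reflexive (ℕ.*-identityʳ _)))

    reachable-block : ∀ {p x} → (p , x) ∈ reachable → p ∈ Blocks
    reachable-block h = Route.path∈ (reachable-route h)

    base-reachable : ∀ {p x} → (p , x) ∈ Base → p ∈ Blocks → (p , x) ∈ reachable
    base-reachable {p} px∈ p∈ = reachable-intro {us = []} {ts = []} px∈ p∈ p∈ refl refl

    descend-reachable : ∀ {p x} t → (p , x) ∈ reachable → down t ∷ p ∈ Blocks → (down t ∷ p , descend t x) ∈ reachable
    descend-reachable t h t∷p∈ with reachable-route h
    ... | record { source∈ = qe∈ ; turn∈ = r∈ ; downs = ts ; source≡ = q≡ ; path≡ = refl ; value≡ = refl } =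
      reachable-intro {ts = t ∷ ts} qe∈ r∈ t∷p∈ q≡ refl

    ascend-reachable : ∀ {p x} u → (up u ∷ p , x) ∈ reachable → (p , ascend u x) ∈ reachable
    ascend-reachable {p} u h with reachable-route h
    ... | record { source = q ; value = e ; source∈ = qe∈ ; turn∈ = r∈ ; ups = us ; downs = [] ; source≡ = q≡ ; path≡ = refl ; value≡ = refl } =
      subst (λ y → (p , y) ∈ reachable) (List.foldl-++ _ e us (u ∷ []))
        (reachable-intro {us = us ++ u ∷ []} {ts = []} qe∈ (Blocks-tail r∈) (Blocks-tail r∈) q≡′ refl)
      where
        q≡′ : q ≡ map up (us ++ u ∷ []) ++ p
        q≡′ = trans q≡ (trans (sym (List.++-assoc (map up us) (up u ∷ []) p)) (cong (_++ p) (sym (List.map-++ up us (u ∷ [])))))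
    ... | record { downs = t ∷ ts ; path≡ = e } = contradiction (List.∷-injectiveˡ e) up≢down

    reachable-preserves : (P : V → Set) → (∀ {q e} → (q , e) ∈ Base → P e) →
                          (∀ u {x} → P x → P (ascend u x)) → (∀ t {x} → P x → P (descend t x)) →
                          ∀ {p x} → (p , x) ∈ reachable → P x
    reachable-preserves P base ascend-P descend-P h with reachable-route h
    ... | record { value = e ; source∈ = qe∈ ; ups = us ; downs = ts ; value≡ = refl } = descending ts (ascending us (base qe∈))
      where
        ascending : ∀ us {x} → P x → P (ascendAll us x)
        ascending []       px = px
        ascending (u ∷ us) px = ascending us (ascend-P u px)

        descending : ∀ ts {x} → P x → P (descendAll ts x)
        descending []       px = px
        descending (t ∷ ts) px = descend-P t (descending ts px)

    StartsDown : Path → Set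
    StartsDown p = ∃₂ λ t p′ → p ≡ down t ∷ p′

    reachable-startsDown : (∀ {q e} → (q , e) ∈ Base → StartsDown q) → ∀ {p x} → (p , x) ∈ reachable → StartsDown p
    reachable-startsDown base h with reachable-route h
    ... | record { downs = t ∷ ts ; path≡ = refl } = t , _ , refl
    ... | record { source∈ = qe∈ ; ups = [] ; downs = [] ; source≡ = refl ; path≡ = refl } = base qe∈
    ... | record { source∈ = qe∈ ; ups = u ∷ us ; downs = [] ; source≡ = refl } with base qe∈
    ...   | t , _ , e = contradiction (List.∷-injectiveˡ e) up≢down

module Occurrences (𝓗 : CCDHeyting) (nG nF : ℕ) where
  open LE-FALC 𝓗 nG nF hiding (A; X; val)
  open Paths nG nF

  -- The path of an occurrence lists the modalities above it, innermost first.
  under : Modality → Path × Concept → Path × Concept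
  under m (p , E) = p ++ m ∷ [] , E

  occurrences strictOccurrences : Concept → List (Path × Concept)
  occurrences C = ([] , C) ∷ strictOccurrences C

  strictOccurrences (prim _)  = []
  strictOccurrences (C ⊓ D)   = occurrences C ++ occurrences D
  strictOccurrences (C ⊔ D)   = occurrences C ++ occurrences D
  strictOccurrences ([ g ] C) = map (under (inj₁ g)) (occurrences C)
  strictOccurrences (⟨ d ⟩ C) = map (under (inj₂ d)) (occurrences C)

  data Child : Path × Concept → Path × Concept → Set where
    ⊓ˡ : ∀ {p C D} → Child (p , C ⊓ D) (p , C)
    ⊓ʳ : ∀ {p C D} → Child (p , C ⊓ D) (p , D)
    ⊔ˡ : ∀ {p C D} → Child (p , C ⊔ D) (p , C)
    ⊔ʳ : ∀ {p C D} → Child (p , C ⊔ D) (p , D)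
    □  : ∀ {p g C} → Child (p , [ g ] C) (inj₁ g ∷ p , C)
    ◇  : ∀ {p d C} → Child (p , ⟨ d ⟩ C) (inj₂ d ∷ p , C)

  child-under : ∀ m {p E p′ E′} → Child (p ++ m ∷ [] , E) (p′ , E′) → ∃ λ p″ → Child (p , E) (p″ , E′) × p′ ≡ p″ ++ m ∷ []
  child-under m ⊓ˡ = _ , ⊓ˡ , refl
  child-under m ⊓ʳ = _ , ⊓ʳ , refl
  child-under m ⊔ˡ = _ , ⊔ˡ , refl
  child-under m ⊔ʳ = _ , ⊔ʳ , refl
  child-under m □  = _ , □ , refl
  child-under m ◇  = _ , ◇ , refl

  under-elim : ∀ m (xs : List (Path × Concept)) {p E} → (p , E) ∈ map (under m) xs → ∃ λ p₀ → (p₀ , E) ∈ xs × p ≡ p₀ ++ m ∷ []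
  under-elim m xs h with ∈-map⁻ (under m) h
  ... | (p₀ , _) , h₀ , refl = p₀ , h₀ , refl

  occurrences-closed : ∀ C {p E p′ E′} → (p , E) ∈ occurrences C → Child (p , E) (p′ , E′) → (p′ , E′) ∈ occurrences C
  occurrences-closed (C ⊓ D) (here refl) ⊓ˡ = there (here refl)
  occurrences-closed (C ⊓ D) (here refl) ⊓ʳ = there (∈-++⁺ʳ (occurrences C) (here refl))
  occurrences-closed (C ⊔ D) (here refl) ⊔ˡ = there (here refl)
  occurrences-closed (C ⊔ D) (here refl) ⊔ʳ = there (∈-++⁺ʳ (occurrences C) (here refl))
  occurrences-closed ([ g ] C) (here refl) □ = there (∈-map⁺ (under (inj₁ g)) {x = [] , C} (here refl))
  occurrences-closed (⟨ d ⟩ C) (here refl) ◇ = there (∈-map⁺ (under (inj₂ d)) {x = [] , C} (here refl))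
  occurrences-closed (C ⊓ D) (there h) ch with ∈-++⁻ (occurrences C) h
  ... | inj₁ hC = there (∈-++⁺ˡ (occurrences-closed C hC ch))
  ... | inj₂ hD = there (∈-++⁺ʳ (occurrences C) (occurrences-closed D hD ch))
  occurrences-closed (C ⊔ D) (there h) ch with ∈-++⁻ (occurrences C) h
  ... | inj₁ hC = there (∈-++⁺ˡ (occurrences-closed C hC ch))
  ... | inj₂ hD = there (∈-++⁺ʳ (occurrences C) (occurrences-closed D hD ch))
  occurrences-closed ([ g ] C) (there h) ch with under-elim (inj₁ g) (occurrences C) h
  ... | p₀ , h₀ , refl with child-under (inj₁ g) ch
  ... | _ , ch₀ , refl = there (∈-map⁺ (under (inj₁ g)) (occurrences-closed C h₀ ch₀))
  occurrences-closed (⟨ d ⟩ C) (there h) ch with under-elim (inj₂ d) (occurrences C) h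
  ... | p₀ , h₀ , refl with child-under (inj₂ d) ch
  ... | _ , ch₀ , refl = there (∈-map⁺ (under (inj₂ d)) (occurrences-closed C h₀ ch₀))

  occurrences-tail : ∀ C {m p E} → (m ∷ p , E) ∈ occurrences C → ∃ λ E′ → (p , E′) ∈ occurrences C
  occurrences-tail (C ⊓ D) (there h) with ∈-++⁻ (occurrences C) h
  ... | inj₁ hC = let E′ , h′ = occurrences-tail C hC in E′ , there (∈-++⁺ˡ h′)
  ... | inj₂ hD = let E′ , h′ = occurrences-tail D hD in E′ , there (∈-++⁺ʳ (occurrences C) h′)
  occurrences-tail (C ⊔ D) (there h) with ∈-++⁻ (occurrences C) h
  ... | inj₁ hC = let E′ , h′ = occurrences-tail C hC in E′ , there (∈-++⁺ˡ h′)
  ... | inj₂ hD = let E′ , h′ = occurrences-tail D hD in E′ , there (∈-++⁺ʳ (occurrences C) h′)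
  occurrences-tail ([ g ] C) (there h) with under-elim (inj₁ g) (occurrences C) h
  ... | [] , _ , refl = [ g ] C , here refl
  ... | _ ∷ _ , h₀ , refl = let E′ , h′ = occurrences-tail C h₀ in E′ , there (∈-map⁺ (under (inj₁ g)) h′)
  occurrences-tail (⟨ d ⟩ C) (there h) with under-elim (inj₂ d) (occurrences C) h
  ... | [] , _ , refl = ⟨ d ⟩ C , here refl
  ... | _ ∷ _ , h₀ , refl = let E′ , h′ = occurrences-tail C h₀ in E′ , there (∈-map⁺ (under (inj₂ d)) h′)

  occurrences-trans : ∀ C {q C₁ p E} → (q , C₁) ∈ occurrences C → (p , E) ∈ occurrences C₁ → (p ++ q , E) ∈ occurrences C
  occurrences-trans C {p = p} {E} (here refl) h = subst (λ p′ → (p′ , E) ∈ occurrences C) (sym (List.++-identityʳ p)) h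
  occurrences-trans (C ⊓ D) (there h) h′ with ∈-++⁻ (occurrences C) h
  ... | inj₁ hC = there (∈-++⁺ˡ (occurrences-trans C hC h′))
  ... | inj₂ hD = there (∈-++⁺ʳ (occurrences C) (occurrences-trans D hD h′))
  occurrences-trans (C ⊔ D) (there h) h′ with ∈-++⁻ (occurrences C) h
  ... | inj₁ hC = there (∈-++⁺ˡ (occurrences-trans C hC h′))
  ... | inj₂ hD = there (∈-++⁺ʳ (occurrences C) (occurrences-trans D hD h′))
  occurrences-trans ([ g ] C) {p = p} {E} (there h) h′ with under-elim (inj₁ g) (occurrences C) h
  ... | q₀ , h₀ , refl = there (subst (λ p′ → (p′ , E) ∈ strictOccurrences ([ g ] C)) (List.++-assoc p q₀ (inj₁ g ∷ []))
                                      (∈-map⁺ (under (inj₁ g)) (occurrences-trans C h₀ h′)))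
  occurrences-trans (⟨ d ⟩ C) {p = p} {E} (there h) h′ with under-elim (inj₂ d) (occurrences C) h
  ... | q₀ , h₀ , refl = there (subst (λ p′ → (p′ , E) ∈ strictOccurrences (⟨ d ⟩ C)) (List.++-assoc p q₀ (inj₂ d ∷ []))
                                      (∈-map⁺ (under (inj₂ d)) (occurrences-trans C h₀ h′)))

  length-occurrences : ∀ C → length (occurrences C) ≡ conceptSize C
  length-occurrences (prim _)  = refl
  length-occurrences (C ⊓ D)   = cong suc (trans (List.length-++ (occurrences C)) (cong₂ _+_ (length-occurrences C) (length-occurrences D)))
  length-occurrences (C ⊔ D)   = cong suc (trans (List.length-++ (occurrences C)) (cong₂ _+_ (length-occurrences C) (length-occurrences D)))
  length-occurrences ([ g ] C) = cong suc (trans (List.length-map _ (occurrences C)) (length-occurrences C))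
  length-occurrences (⟨ d ⟩ C) = cong suc (trans (List.length-map _ (occurrences C)) (length-occurrences C))

  occurrence-size : ∀ C {p E} → (p , E) ∈ occurrences C → conceptSize E ≤ conceptSize C
  occurrence-size C (here refl) = ℕ.≤-refl
  occurrence-size (C ⊓ D) (there h) with ∈-++⁻ (occurrences C) h
  ... | inj₁ hC = ℕ.≤-trans (occurrence-size C hC) (ℕ.m≤n⇒m≤1+n (ℕ.m≤m+n _ _))
  ... | inj₂ hD = ℕ.≤-trans (occurrence-size D hD) (ℕ.m≤n⇒m≤1+n (ℕ.m≤n+m _ (conceptSize C)))
  occurrence-size (C ⊔ D) (there h) with ∈-++⁻ (occurrences C) h
  ... | inj₁ hC = ℕ.≤-trans (occurrence-size C hC) (ℕ.m≤n⇒m≤1+n (ℕ.m≤m+n _ _))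
  ... | inj₂ hD = ℕ.≤-trans (occurrence-size D hD) (ℕ.m≤n⇒m≤1+n (ℕ.m≤n+m _ (conceptSize C)))
  occurrence-size ([ g ] C) (there h) with under-elim (inj₁ g) (occurrences C) h
  ... | _ , h₀ , refl = ℕ.m≤n⇒m≤1+n (occurrence-size C h₀)
  occurrence-size (⟨ d ⟩ C) (there h) with under-elim (inj₂ d) (occurrences C) h
  ... | _ , h₀ , refl = ℕ.m≤n⇒m≤1+n (occurrence-size C h₀)

module PolynomialBounds (s : ℕ) where
  -- Opaque: otherwise the typechecker unfolds the powers of (s + 1).
  opaque
    power : ℕ → ℕ
    power k = suc s ^ k

    power-≡ : ∀ k → power k ≡ (s + 1) ^ k
    power-≡ k = cong (_^ k) (ℕ.+-comm 1 s)

  record Bounded (n c k : ℕ) : Set where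
    constructor bounded
    field ≤-poly : n ≤ c * power k

  open Bounded public

  ≤-bounded : ∀ {a b c k} → a ≤ b → Bounded b c k → Bounded a c k
  ≤-bounded a≤b (bounded b≤) = bounded (ℕ.≤-trans a≤b b≤)

  +-bounded : ∀ {a b c₁ c₂ k} → Bounded a c₁ k → Bounded b c₂ k → Bounded (a + b) (c₁ + c₂) k
  +-bounded {c₁ = c₁} {c₂} {k} (bounded a≤) (bounded b≤) =
    bounded (ℕ.≤-trans (ℕ.+-mono-≤ a≤ b≤) (ℕ.≤-reflexive (sym (ℕ.*-distribʳ-+ (power k) c₁ c₂))))

  opaque
    unfolding power

    *-bounded : ∀ {a b c₁ c₂ k₁ k₂} → Bounded a c₁ k₁ → Bounded b c₂ k₂ → Bounded (a * b) (c₁ * c₂) (k₁ + k₂)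
    *-bounded {c₁ = c₁} {c₂} {k₁} {k₂} (bounded a≤) (bounded b≤) = bounded (ℕ.≤-trans (ℕ.*-mono-≤ a≤ b≤) (ℕ.≤-reflexive
      (trans (ℕ.[m*n]*[o*p]≡[m*o]*[n*p] c₁ _ c₂ _) (cong (c₁ * c₂ *_) (sym (ℕ.^-distribˡ-+-* (suc s) k₁ k₂))))))

    raise-bounded : ∀ {a c k k′} → k ≤ k′ → Bounded a c k → Bounded a c k′
    raise-bounded {c = c} k≤k′ (bounded a≤) = bounded (ℕ.≤-trans a≤ (ℕ.*-monoʳ-≤ c (ℕ.^-monoʳ-≤ (suc s) k≤k′)))

    const-bounded : ∀ c → Bounded c c 0
    const-bounded c = bounded (ℕ.≤-reflexive (sym (ℕ.*-identityʳ c)))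

    1-bounded : ∀ k → Bounded 1 1 k
    1-bounded k = bounded (ℕ.≤-trans (ℕ.m^n>0 (suc s) k) (ℕ.≤-reflexive (sym (ℕ.*-identityˡ _))))

    s-bounded : Bounded s 1 1
    s-bounded = bounded (ℕ.≤-trans (ℕ.n≤1+n s) (ℕ.≤-reflexive (sym (trans (ℕ.*-identityˡ _) (ℕ.*-identityʳ _)))))

module ABoxSyntax (𝓗 : CCDHeyting) (nG nF : ℕ) (𝒜 : LE-FALC.ABox 𝓗 nG nF) where
  open LE-FALC 𝓗 nG nF hiding (A; X; val)
  open Paths nG nF
  open Occurrences 𝓗 nG nF
  open PolynomialBounds (aboxSize 𝒜)

  term : Assertion → Term
  term (_ ≤ₐ t) = t
  term (_ ≰ₐ t) = t

  termConcepts : Term → List Concept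
  termConcepts (_ ∶ C)  = C ∷ []
  termConcepts (_ ∷∶ C) = C ∷ []
  termConcepts _        = []

  termObjects : Term → List ObjName
  termObjects (b ∶ _)       = b ∷ []
  termObjects (_ ∷∶ _)      = []
  termObjects I[ b , _ ]    = b ∷ []
  termObjects (R□[ _ ] b _) = b ∷ []
  termObjects (R◇[ _ ] _ b) = b ∷ []

  termFeatures : Term → List FeatName
  termFeatures (_ ∶ _)       = []
  termFeatures (y ∷∶ _)      = y ∷ []
  termFeatures I[ _ , y ]    = y ∷ []
  termFeatures (R□[ _ ] _ y) = y ∷ []
  termFeatures (R◇[ _ ] y _) = y ∷ []

  aboxSize-∈ : ∀ {φ} (ℬ : ABox) → φ ∈ ℬ → assertionSize φ ≤ aboxSize ℬ
  aboxSize-∈ (φ ∷ ℬ) (here refl) = ℕ.m≤m+n _ _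
  aboxSize-∈ (φ ∷ ℬ) (there h)   = ℕ.≤-trans (aboxSize-∈ ℬ h) (ℕ.m≤n+m _ _)

  length≤aboxSize : ∀ (ℬ : ABox) → length ℬ * 1 ≤ aboxSize ℬ
  length≤aboxSize []            = z≤n
  length≤aboxSize ((_ ≤ₐ _) ∷ ℬ) = ℕ.+-mono-≤ (s≤s z≤n) (length≤aboxSize ℬ)
  length≤aboxSize ((_ ≰ₐ _) ∷ ℬ) = ℕ.+-mono-≤ (s≤s z≤n) (length≤aboxSize ℬ)

  term-size : ∀ {C} φ → C ∈ termConcepts (term φ) → conceptSize C ≤ assertionSize φ
  term-size (_ ≤ₐ (_ ∶ _))  (here refl) = ℕ.m≤n+m _ 3
  term-size (_ ≤ₐ (_ ∷∶ _)) (here refl) = ℕ.m≤n+m _ 3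
  term-size (_ ≰ₐ (_ ∶ _))  (here refl) = ℕ.m≤n+m _ 3
  term-size (_ ≰ₐ (_ ∷∶ _)) (here refl) = ℕ.m≤n+m _ 3

  -- All occurrences of subconcepts of occurrences, re-rooted: this makes the
  -- set of occurrences closed under dropping the outer modal context.
  reRooted : Concept → List (Path × Concept)
  reRooted C₀ = concatMap (occurrences ∘ proj₂) (occurrences C₀)

  -- Abstract for the same reason as Transport.reachable.
  abstract
    concepts : List Concept
    concepts = concatMap (termConcepts ∘ term) 𝒜

    objNames : List ObjName
    objNames = concatMap (termObjects ∘ term) 𝒜

    featNames : List FeatName
    featNames = concatMap (termFeatures ∘ term) 𝒜

    concept∈ : ∀ {φ C} → φ ∈ 𝒜 → C ∈ termConcepts (term φ) → C ∈ concepts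
    concept∈ = ∈-concatMap-intro (termConcepts ∘ term)

    objName∈ : ∀ {φ b} → φ ∈ 𝒜 → b ∈ termObjects (term φ) → b ∈ objNames
    objName∈ = ∈-concatMap-intro (termObjects ∘ term)

    featName∈ : ∀ {φ y} → φ ∈ 𝒜 → y ∈ termFeatures (term φ) → y ∈ featNames
    featName∈ = ∈-concatMap-intro (termFeatures ∘ term)

    per-assertion : ∀ {T : Set} (f : Term → List T) → (∀ t → length (f t) ≤ 1) →
                    Bounded (length (concatMap (f ∘ term) 𝒜)) 1 1
    per-assertion f ≤1 = ≤-bounded (ℕ.≤-trans (length-concatMap-≤ (f ∘ term) 𝒜 (λ {φ} _ → ≤1 (term φ))) (length≤aboxSize 𝒜))
                                   s-bounded

    concepts-bounded : Bounded (length concepts) 1 1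
    concepts-bounded = per-assertion termConcepts
      (λ { (_ ∶ _) → s≤s z≤n ; (_ ∷∶ _) → s≤s z≤n ; I[ _ , _ ] → z≤n ; (R□[ _ ] _ _) → z≤n ; (R◇[ _ ] _ _) → z≤n })

    objNames-bounded : Bounded (length objNames) 1 1
    objNames-bounded = per-assertion termObjects
      (λ { (_ ∶ _) → s≤s z≤n ; (_ ∷∶ _) → z≤n ; I[ _ , _ ] → s≤s z≤n ; (R□[ _ ] _ _) → s≤s z≤n ; (R◇[ _ ] _ _) → s≤s z≤n })

    featNames-bounded : Bounded (length featNames) 1 1
    featNames-bounded = per-assertion termFeatures
      (λ { (_ ∶ _) → z≤n ; (_ ∷∶ _) → s≤s z≤n ; I[ _ , _ ] → s≤s z≤n ; (R□[ _ ] _ _) → s≤s z≤n ; (R◇[ _ ] _ _) → s≤s z≤n })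

    concept-size : ∀ {C} → C ∈ concepts → conceptSize C ≤ aboxSize 𝒜
    concept-size h = let φ , φ∈ , C∈ = ∈-concatMap-elim (termConcepts ∘ term) h in
      ℕ.≤-trans (term-size φ C∈) (aboxSize-∈ 𝒜 φ∈)

    allOccurrences : List (Path × Concept)
    allOccurrences = concatMap reRooted concepts

    allOccurrences-bounded : Bounded (length allOccurrences) 1 3
    allOccurrences-bounded = ≤-bounded
      (length-concatMap-≤ reRooted concepts (λ C∈ → reRooted-≤ (concept-size C∈)))
      (*-bounded concepts-bounded (*-bounded s-bounded s-bounded))
      where
        s : ℕ
        s = aboxSize 𝒜

        reRooted-≤ : ∀ {C₀} → conceptSize C₀ ≤ s → length (reRooted C₀) ≤ s * s
        reRooted-≤ {C₀} C₀≤ = ℕ.≤-trans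
          (length-concatMap-≤ (occurrences ∘ proj₂) (occurrences C₀)
            (λ {(_ , C₁)} C₁∈ → ℕ.≤-trans (ℕ.≤-reflexive (length-occurrences C₁)) (ℕ.≤-trans (occurrence-size C₀ C₁∈) C₀≤)))
          (ℕ.*-monoˡ-≤ s (ℕ.≤-trans (ℕ.≤-reflexive (length-occurrences C₀)) C₀≤))

  Occurs : Path → Concept → Set
  Occurs p C = (p , C) ∈ allOccurrences

  record Occurrence (p : Path) (C : Concept) : Set where
    constructor occurrence
    field
      {outer}  : Concept
      outer∈   : outer ∈ concepts
      {q}      : Path
      {middle} : Concept
      middle∈  : (q , middle) ∈ occurrences outer
      inner∈   : (p , C) ∈ occurrences middle

  abstract
    Occurs-elim : ∀ {p C} → Occurs p C → Occurrence p C
    Occurs-elim h = let C₀ , C₀∈ , h₁ = ∈-concatMap-elim reRooted h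
                        _  , h₂  , h₃ = ∈-concatMap-elim (occurrences ∘ proj₂) h₁
                    in occurrence C₀∈ h₂ h₃

    Occurs-intro : ∀ {p C} → Occurrence p C → Occurs p C
    Occurs-intro (occurrence outer∈ middle∈ inner∈) =
      ∈-concatMap-intro reRooted outer∈ (∈-concatMap-intro (occurrences ∘ proj₂) middle∈ inner∈)

    Blocks : List Path
    Blocks = [] ∷ map proj₁ allOccurrences

    []∈Blocks : [] ∈ Blocks
    []∈Blocks = here refl

    Occurs-block : ∀ {p C} → Occurs p C → p ∈ Blocks
    Occurs-block h = there (∈-map⁺ proj₁ h)

    Blocks-tail : ∀ {m p} → m ∷ p ∈ Blocks → p ∈ Blocks
    Blocks-tail {m} {p} (there h) = tail-of (∈-map⁻ proj₁ h)
      where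
        tail-of : ∃ (λ o → o ∈ allOccurrences × m ∷ p ≡ proj₁ o) → p ∈ Blocks
        tail-of ((_ , _) , h′ , refl) = let open Occurrence (Occurs-elim h′) in
          Occurs-block (Occurs-intro (occurrence outer∈ middle∈ (proj₂ (occurrences-tail middle inner∈))))

    Blocks-bounded : Bounded (length Blocks) 2 3
    Blocks-bounded = ≤-bounded (ℕ.≤-reflexive (cong suc (List.length-map proj₁ allOccurrences)))
                               (+-bounded (1-bounded 3) allOccurrences-bounded)

  Occurs-concept : ∀ {C} → C ∈ concepts → Occurs [] C
  Occurs-concept C∈ = Occurs-intro (occurrence C∈ (here refl) (here refl))

  Occurs-child : ∀ {p C p′ C′} → Occurs p C → Child (p , C) (p′ , C′) → Occurs p′ C′
  Occurs-child h ch = let open Occurrence (Occurs-elim h) in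
    Occurs-intro (occurrence outer∈ middle∈ (occurrences-closed middle inner∈ ch))

  Occurs-reroot : ∀ {C m C′} → Occurs [] C → Child ([] , C) (m ∷ [] , C′) → Occurs [] C′
  Occurs-reroot h ch = let open Occurrence (Occurs-elim h) in
    Occurs-intro (occurrence outer∈ (occurrences-trans outer middle∈ (occurrences-closed middle inner∈ ch)) (here refl))

-- The constant produced by the counting in Filtration.Side.points-bounded.
sideConstant : ℕ → ℕ → ℕ
sideConstant nU nD = 12 + (12 * (nD + nU) + 12 * (nD + nU) * nD * 4)

module Filtration (𝓗 : CCDHeyting) (nG nF : ℕ) (M : LE-FALC.Interpretation 𝓗 nG nF) (𝒜 : LE-FALC.ABox 𝓗 nG nF) where
  open CCDHeyting 𝓗 renaming (_≤_ to _⊑_)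
  open HeytingFacts 𝓗
  open LE-FALC 𝓗 nG nF hiding (A; X; val)
  open InterpretationFacts 𝓗 nG nF using (⟨/⟩-≼)
  open InterpretationFacts.Model 𝓗 nG nF M
  open Interpretation M hiding (_↑; _↓)
  open Paths nG nF
  open Occurrences 𝓗 nG nF using (⊓ˡ; ⊓ʳ; ⊔ˡ; ⊔ʳ; □; ◇)
  open ABoxSyntax 𝓗 nG nF 𝒜
  open PolynomialBounds (aboxSize 𝒜)

  Ext : Set
  Ext = A → H

  -- A point of the finite context: a node of the tree of paths, an extent of M
  -- (for a feature, the extent whose intent it stands for), and whether it is one
  -- of the extra root witnesses that make the modal relations I-compatible.
  record Point : Set where
    constructor point
    field
      path    : Path
      extent  : Ext
      witness : Bool

  open Point

  regular : Path × Ext → Point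
  regular (p , x) = point p x false

  rootWitness : Ext → Point
  rootWitness w = point [] w true

  module Side {nU nD : ℕ} (orientation : (Fin nU ⊎ Fin nD) ↔ Modality)
              (ascend : Fin nU → Ext → Ext) (descend : Fin nD → Ext → Ext)
              (base : List (Path × Ext)) where

    module Regular = Transport orientation ascend descend Blocks Blocks-tail base
    open Regular using (up; down; up≢down)

    witnessesOf : Path × Ext → List Ext
    witnessesOf ([] , x)    = map (λ t → descend t x) (allFin nD) ++ map (λ u → ascend u x) (allFin nU)
    witnessesOf (_ ∷ _ , _) = []

    witnesses : List Ext
    witnesses = concatMap witnessesOf Regular.reachable

    seedsOf : Ext → List (Path × Ext)
    seedsOf w = map (λ t → down t ∷ [] , descend t w) (allFin nD)

    seeds : List (Path × Ext)
    seeds = concatMap seedsOf witnesses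

    -- Root witnesses are not regular points, but their descendants are needed too.
    module Seeded = Transport orientation ascend descend Blocks Blocks-tail seeds

    points : List Point
    points = map regular Regular.reachable ++ map rootWitness witnesses ++ map regular Seeded.reachable

    data Origin : Point → Set where
      regular⁺ : ∀ {p x} → (p , x) ∈ Regular.reachable → Origin (point p x false)
      witness⁺ : ∀ {w} → w ∈ witnesses → Origin (point [] w true)
      seeded⁺  : ∀ {p x} → (p , x) ∈ Seeded.reachable → Origin (point p x false)

    origin : ∀ {o} → o ∈ points → Origin o
    origin h with ∈-++⁻ (map regular Regular.reachable) h
    ... | inj₁ h₁ with ∈-map⁻ regular h₁
    ...   | _ , h₂ , refl = regular⁺ h₂
    origin h | inj₂ h₁ with ∈-++⁻ (map rootWitness witnesses) h₁
    ... | inj₁ h₂ with ∈-map⁻ rootWitness h₂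
    ...   | _ , h₃ , refl = witness⁺ h₃
    origin h | inj₂ h₁ | inj₂ h₂ with ∈-map⁻ regular h₂
    ...   | _ , h₃ , refl = seeded⁺ h₃

    regular∈ : ∀ {p x} → (p , x) ∈ Regular.reachable → point p x false ∈ points
    regular∈ h = ∈-++⁺ˡ (∈-map⁺ regular h)

    witness∈ : ∀ {w} → w ∈ witnesses → point [] w true ∈ points
    witness∈ h = ∈-++⁺ʳ (map regular Regular.reachable) (∈-++⁺ˡ (∈-map⁺ rootWitness h))

    seeded∈ : ∀ {p x} → (p , x) ∈ Seeded.reachable → point p x false ∈ points
    seeded∈ h = ∈-++⁺ʳ (map regular Regular.reachable) (∈-++⁺ʳ (map rootWitness witnesses) (∈-map⁺ regular h))

    base∈ : ∀ {p x} → (p , x) ∈ base → p ∈ Blocks → point p x false ∈ points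
    base∈ h p∈ = regular∈ (Regular.base-reachable h p∈)

    witnessesOf-elim : ∀ {p x w} → w ∈ witnessesOf (p , x) → (∃ λ t → w ≡ descend t x) ⊎ (∃ λ u → w ≡ ascend u x)
    witnessesOf-elim {[]} {x} h with ∈-++⁻ (map (λ t → descend t x) (allFin nD)) h
    ... | inj₁ h₁ = let t , _ , w≡ = ∈-map⁻ (λ t → descend t x) h₁ in inj₁ (t , w≡)
    ... | inj₂ h₁ = let u , _ , w≡ = ∈-map⁻ (λ u → ascend u x) h₁ in inj₂ (u , w≡)

    seeded-startsDown : ∀ {p x} → (p , x) ∈ Seeded.reachable → Seeded.StartsDown p
    seeded-startsDown = Seeded.reachable-startsDown seed-startsDown
      where
        seed-startsDown : ∀ {q e} → (q , e) ∈ seeds → Seeded.StartsDown q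
        seed-startsDown h with ∈-concatMap-elim seedsOf {witnesses} h
        ... | w , _ , h₁ with ∈-map⁻ (λ t → down t ∷ [] , descend t w) h₁
        ...   | t , _ , refl = t , [] , refl

    points-block : ∀ {o} → o ∈ points → path o ∈ Blocks
    points-block h with origin h
    ... | regular⁺ r = Regular.reachable-block r
    ... | witness⁺ _ = []∈Blocks
    ... | seeded⁺ r  = Seeded.reachable-block r

    descend-closed : ∀ {o} t → o ∈ points → down t ∷ path o ∈ Blocks →
                     point (down t ∷ path o) (descend t (extent o)) false ∈ points
    descend-closed t h t∷p∈ with origin h
    ... | regular⁺ r = regular∈ (Regular.descend-reachable t r t∷p∈)
    ... | seeded⁺ r  = seeded∈ (Seeded.descend-reachable t r t∷p∈)
    ... | witness⁺ {w} w∈ = seeded∈ (Seeded.base-reachable (∈-concatMap-intro seedsOf w∈ (∈-map⁺ (λ t → down t ∷ [] , descend t w) (∈-allFin t))) t∷p∈)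

    ascend-closed : ∀ {o p} u → o ∈ points → path o ≡ up u ∷ p → point p (ascend u (extent o)) false ∈ points
    ascend-closed u h e with origin h
    ... | regular⁺ {x = x} r = regular∈ (Regular.ascend-reachable u (subst (λ q → (q , x) ∈ Regular.reachable) e r))
    ... | witness⁺ _  = contradiction e (λ ())
    ... | seeded⁺ r with seeded-startsDown r
    ...   | t , _ , e′ = contradiction (List.∷-injectiveˡ (trans (sym e) e′)) up≢down

    root-witnesses : ∀ {o} → o ∈ points → path o ≡ [] → witness o ≡ false →
                     (∀ t → point [] (descend t (extent o)) true ∈ points) × (∀ u → point [] (ascend u (extent o)) true ∈ points)
    root-witnesses h e w with origin h
    ... | witness⁺ _ = contradiction w (λ ())
    ... | seeded⁺ r with seeded-startsDown r
    ...   | _ , _ , e′ = contradiction (trans (sym e) e′) (λ ())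
    root-witnesses h refl w | regular⁺ {x = x} r =
        (λ t → witness∈ (∈-concatMap-intro witnessesOf r (∈-++⁺ˡ (∈-map⁺ (λ t → descend t x) (∈-allFin t)))))
      , (λ u → witness∈ (∈-concatMap-intro witnessesOf r
                  (∈-++⁺ʳ (map (λ t → descend t x) (allFin nD)) (∈-map⁺ (λ u → ascend u x) (∈-allFin u)))))

    module _ (P : Ext → Set) (base-P : ∀ {q e} → (q , e) ∈ base → P e)
             (ascend-P : ∀ u {x} → P x → P (ascend u x)) (descend-P : ∀ t {x} → P x → P (descend t x)) where

      witnesses-preserve : ∀ {w} → w ∈ witnesses → P w
      witnesses-preserve w∈ with ∈-concatMap-elim witnessesOf {Regular.reachable} w∈
      ... | (p , x) , r , h with witnessesOf-elim {p} {x} h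
      ...   | inj₁ (t , refl) = descend-P t (Regular.reachable-preserves P base-P ascend-P descend-P r)
      ...   | inj₂ (u , refl) = ascend-P u (Regular.reachable-preserves P base-P ascend-P descend-P r)

      seeds-preserve : ∀ {q e} → (q , e) ∈ seeds → P e
      seeds-preserve h with ∈-concatMap-elim seedsOf {witnesses} h
      ... | w , w∈ , h₁ with ∈-map⁻ (λ t → down t ∷ [] , descend t w) h₁
      ...   | t , _ , refl = descend-P t (witnesses-preserve w∈)

      points-preserve : ∀ {o} → o ∈ points → P (extent o)
      points-preserve h with origin h
      ... | regular⁺ r  = Regular.reachable-preserves P base-P ascend-P descend-P r
      ... | witness⁺ w∈ = witnesses-preserve w∈
      ... | seeded⁺ r   = Seeded.reachable-preserves P seeds-preserve ascend-P descend-P r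

    length-points : length points ≡ length Regular.reachable + (length witnesses + length Seeded.reachable)
    length-points = trans (List.length-++ (map regular Regular.reachable))
      (cong₂ _+_ (List.length-map regular Regular.reachable)
                 (trans (List.length-++ (map rootWitness witnesses))
                        (cong₂ _+_ (List.length-map rootWitness witnesses) (List.length-map regular Seeded.reachable))))

    points-bounded : Bounded (length base) 3 3 → Bounded (length points) (sideConstant nU nD) 15
    points-bounded base-bounded = ≤-bounded (ℕ.≤-reflexive length-points)
      (+-bounded (raise-bounded (ℕ.m≤m+n 9 6) regular-bounded)
        (+-bounded (raise-bounded (ℕ.m≤m+n 9 6) witnesses-bounded) seeded-bounded))
      where
        length-map-allFin : ∀ {n} {T : Set} (f : Fin n → T) → length (map f (allFin n)) ≡ n
        length-map-allFin {n} f = trans (List.length-map f (allFin n)) (List.length-tabulate (λ i → i))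

        witnessesOf-≤ : ∀ px → length (witnessesOf px) ≤ nD + nU
        witnessesOf-≤ ([] , x) = ℕ.≤-reflexive (trans (List.length-++ (map (λ t → descend t x) (allFin nD)))
          (cong₂ _+_ (length-map-allFin (λ t → descend t x)) (length-map-allFin (λ u → ascend u x))))
        witnessesOf-≤ (_ ∷ _ , _) = z≤n

        regular-bounded : Bounded (length Regular.reachable) 12 9
        regular-bounded = ≤-bounded Regular.length-reachable (*-bounded base-bounded (*-bounded Blocks-bounded Blocks-bounded))

        witnesses-bounded : Bounded (length witnesses) (12 * (nD + nU)) 9
        witnesses-bounded = ≤-bounded (length-concatMap-≤ witnessesOf Regular.reachable (λ {px} _ → witnessesOf-≤ px))
                                      (*-bounded regular-bounded (const-bounded (nD + nU)))

        seeds-bounded : Bounded (length seeds) (12 * (nD + nU) * nD) 9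
        seeds-bounded = ≤-bounded (length-concatMap-≤ seedsOf witnesses (λ {w} _ → ℕ.≤-reflexive (length-map-allFin _)))
                                  (*-bounded witnesses-bounded (const-bounded nD))

        seeded-bounded : Bounded (length Seeded.reachable) (12 * (nD + nU) * nD * 4) 15
        seeded-bounded = ≤-bounded Seeded.length-reachable (*-bounded seeds-bounded (*-bounded Blocks-bounded Blocks-bounded))

  ⊤ₑ : Ext
  ⊤ₑ _ = ⊤

  occurrenceExtent : Path × Concept → Path × Ext
  occurrenceExtent (p , C) = p , ext C

  namedObject : ObjName → Path × Ext
  namedObject b = [] , objExtent (obj b)

  namedFeature : FeatName → Path × Ext
  namedFeature y = [] , featExtent (feat y)

  objectBase featureBase : List (Path × Ext)
  objectBase  = ([] , ⊤ₑ) ∷ map namedObject objNames ++ map occurrenceExtent allOccurrences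
  featureBase = ([] , ⊤ₑ) ∷ map namedFeature featNames ++ map occurrenceExtent allOccurrences

  -- For objects ◇ leads towards the root and ◆ away from it; for features □ leads
  -- towards the root and ■ away from it.
  module Objects  = Side {nF} {nG} Sum.swap-↔ ◇ᵉ ◆ᵉ objectBase
  module Features = Side {nG} {nF} ↔-refl □ᵉ ■ᵉ featureBase

  top-object : point [] ⊤ₑ false ∈ Objects.points
  top-object = Objects.base∈ (here refl) []∈Blocks

  top-feature : point [] ⊤ₑ false ∈ Features.points
  top-feature = Features.base∈ (here refl) []∈Blocks

  named-object : ∀ {b} → b ∈ objNames → point [] (objExtent (obj b)) false ∈ Objects.points
  named-object b∈ = Objects.base∈ (there (∈-++⁺ˡ (∈-map⁺ namedObject b∈))) []∈Blocks

  named-feature : ∀ {y} → y ∈ featNames → point [] (featExtent (feat y)) false ∈ Features.points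
  named-feature y∈ = Features.base∈ (there (∈-++⁺ˡ (∈-map⁺ namedFeature y∈))) []∈Blocks

  occurrence-object : ∀ {p C} → Occurs p C → point p (ext C) false ∈ Objects.points
  occurrence-object h = Objects.base∈ (there (∈-++⁺ʳ (map namedObject objNames) (∈-map⁺ occurrenceExtent h))) (Occurs-block h)

  occurrence-feature : ∀ {p C} → Occurs p C → point p (ext C) false ∈ Features.points
  occurrence-feature h = Features.base∈ (there (∈-++⁺ʳ (map namedFeature featNames) (∈-map⁺ occurrenceExtent h))) (Occurs-block h)

  feature-isExtent : ∀ {f} → f ∈ Features.points → IsExtent (extent f)
  feature-isExtent = Features.points-preserve IsExtent base-isExtent (λ g _ → □ᵉ-isExtent g _) (λ d _ → ■ᵉ-isExtent d _)
    where
      base-isExtent : ∀ {q e} → (q , e) ∈ featureBase → IsExtent e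
      base-isExtent (here refl) _ = ≤⊤
      base-isExtent (there h) with ∈-++⁻ (map namedFeature featNames) h
      ... | inj₁ h₁ with ∈-map⁻ namedFeature h₁
      ...   | y , _ , refl = featExtent-isExtent (feat y)
      base-isExtent (there h) | inj₂ h₁ with ∈-map⁻ occurrenceExtent h₁
      ...   | (_ , C) , _ , refl = ext-isExtent C

  AtRoot : Point → Set
  AtRoot o = path o ≡ [] × witness o ≡ false

  Linked : Point → Point → Set
  Linked o f = path o ≡ path f × (witness o ≡ false ⊎ witness f ≡ false)

  BoxLinked : Fin nG → Point → Point → Set
  BoxLinked g o f = path f ≡ inj₁ g ∷ path o ⊎ AtRoot o × AtRoot f

  DiaLinked : Fin nF → Point → Point → Set
  DiaLinked d f o = path o ≡ inj₂ d ∷ path f ⊎ AtRoot o × AtRoot f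

  atRoot? : ∀ o → Dec (AtRoot o)
  atRoot? o = (path o ≟ₚ []) ×-dec (witness o Bool.≟ false)

  linked? : ∀ o f → Dec (Linked o f)
  linked? o f = (path o ≟ₚ path f) ×-dec ((witness o Bool.≟ false) ⊎-dec (witness f Bool.≟ false))

  boxLinked? : ∀ g o f → Dec (BoxLinked g o f)
  boxLinked? g o f = (path f ≟ₚ (inj₁ g ∷ path o)) ⊎-dec (atRoot? o ×-dec atRoot? f)

  diaLinked? : ∀ d f o → Dec (DiaLinked d f o)
  diaLinked? d f o = (path o ≟ₚ (inj₂ d ∷ path f)) ⊎-dec (atRoot? o ×-dec atRoot? f)

  A′ X′ : Set
  A′ = ∃ λ o → o ∈ Objects.points
  X′ = ∃ λ f → f ∈ Features.points

  I′ : A′ → X′ → H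
  I′ (o , _) (f , _) = guard (linked? o f) (extent o ≼ extent f)

  R□′ : Fin nG → A′ → X′ → H
  R□′ g (o , _) (f , _) = guard (boxLinked? g o f) (extent o ≼ □ᵉ g (extent f))

  R◇′ : Fin nF → X′ → A′ → H
  R◇′ d (f , _) (o , _) = guard (diaLinked? d f o) (◇ᵉ d (extent o) ≼ extent f)

  open Polarity 𝓗 I′ using ()
    renaming ( _↑ to _↑′ ; _↓ to _↓′ ; IsExtent to IsExtent′ ; IsIntent to IsIntent′
             ; IsExtent-byColumns to IsExtent′-byColumns ; IsIntent-byRows to IsIntent′-byRows
             ; IsExtent-⇒ to IsExtent′-⇒ ; IsIntent-⇒ to IsIntent′-⇒ ; IsExtent-resp to IsExtent′-resp ; IsIntent-resp to IsIntent′-resp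
             ; IsExtent⇒stable to IsExtent′⇒stable ; IsIntent⇒stable to IsIntent′⇒stable ; ↓↑↓ to ↓↑↓′ )

  record ColumnWitness (Cond : A′ → Set) (v : A′ → H) (a : A′) : Set where
    field
      column    : X′
      linked    : Linked (proj₁ a) (proj₁ column)
      attained  : extent (proj₁ a) ≼ extent (proj₁ column) ⊑ v a
      dominated : ∀ a′ → Linked (proj₁ a′) (proj₁ column) → Cond a′ × v a′ ⊑ extent (proj₁ a′) ≼ extent (proj₁ column)

  record RowWitness (Cond : X′ → Set) (v : X′ → H) (x : X′) : Set where
    field
      row       : A′
      linked    : Linked (proj₁ row) (proj₁ x)
      attained  : extent (proj₁ row) ≼ extent (proj₁ x) ⊑ v x
      dominated : ∀ x′ → Linked (proj₁ row) (proj₁ x′) → Cond x′ × v x′ ⊑ extent (proj₁ row) ≼ extent (proj₁ x′)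

  guarded-isExtent′ : ∀ {Cond : A′ → Set} (cond? : ∀ a → Dec (Cond a)) (v : A′ → H) →
                      (∀ a → Cond a → ColumnWitness Cond v a) → IsExtent′ (λ a → guard (cond? a) (v a))
  guarded-isExtent′ cond? v witness = IsExtent′-byColumns cover
    where
      cover : ∀ a → ⊤ ⊑ guard (cond? a) (v a) ⊎ ∃ λ x → (∀ a′ → guard (cond? a′) (v a′) ⊑ I′ a′ x) × I′ a x ⊑ guard (cond? a) (v a)
      cover a with guard-⊤-or (cond? a) {v a}
      ... | inj₁ ⊤≤ = inj₁ ⊤≤
      ... | inj₂ c = let open ColumnWitness (witness a c) in inj₂ (column ,
        (λ a′ → guard-≤ (cond? a′) (linked? (proj₁ a′) (proj₁ column)) (proj₁ ∘ dominated a′) (proj₂ ∘ dominated a′)) ,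
        guard-≤ (linked? (proj₁ a) (proj₁ column)) (cond? a) (λ _ → linked) (λ _ → attained))

  guarded-isIntent′ : ∀ {Cond : X′ → Set} (cond? : ∀ x → Dec (Cond x)) (v : X′ → H) →
                      (∀ x → Cond x → RowWitness Cond v x) → IsIntent′ (λ x → guard (cond? x) (v x))
  guarded-isIntent′ cond? v witness = IsIntent′-byRows cover
    where
      cover : ∀ x → ⊤ ⊑ guard (cond? x) (v x) ⊎ ∃ λ a → (∀ x′ → guard (cond? x′) (v x′) ⊑ I′ a x′) × I′ a x ⊑ guard (cond? x) (v x)
      cover x with guard-⊤-or (cond? x) {v x}
      ... | inj₁ ⊤≤ = inj₁ ⊤≤
      ... | inj₂ c = let open RowWitness (witness x c) in inj₂ (row ,
        (λ x′ → guard-≤ (cond? x′) (linked? (proj₁ row) (proj₁ x′)) (proj₁ ∘ dominated x′) (proj₂ ∘ dominated x′)) ,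
        guard-≤ (linked? (proj₁ row) (proj₁ x)) (cond? x) (λ _ → linked) (λ _ → attained))

  R□′-column-isExtent′ : ∀ g x → IsExtent′ (λ a → R□′ g a x)
  R□′-column-isExtent′ g (f , f∈) = guarded-isExtent′ (λ a → boxLinked? g (proj₁ a) f) _ through
    where
      through : ∀ a → BoxLinked g (proj₁ a) f → ColumnWitness _ _ a
      through (o , _) (inj₁ child) = record
        { column    = point (path o) (□ᵉ g (extent f)) false , Features.ascend-closed g f∈ child
        ; linked    = refl , inj₂ refl
        ; attained  = ≤-refl
        ; dominated = λ { _ (same , _) → inj₁ (trans child (cong (inj₁ g ∷_) (sym same))) , ≤-refl } }
      through (o , _) (inj₂ ((o-root , o-regular) , (f-root , f-regular))) = record
        { column    = point [] (□ᵉ g (extent f)) true , proj₂ (Features.root-witnesses f∈ f-root f-regular) g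
        ; linked    = o-root , inj₁ o-regular
        ; attained  = ≤-refl
        ; dominated = λ { _ (root , inj₁ regular) → inj₂ ((root , regular) , (f-root , f-regular)) , ≤-refl
                        ; _ (_ , inj₂ ()) } }

  R□′-row-isIntent′ : ∀ g a → IsIntent′ (R□′ g a)
  R□′-row-isIntent′ g (o , o∈) = guarded-isIntent′ (λ x → boxLinked? g o (proj₁ x)) _ through
    where
      through : ∀ x → BoxLinked g o (proj₁ x) → RowWitness _ _ x
      through (f , f∈) (inj₁ child) = record
        { row       = point (inj₁ g ∷ path o) (◆ᵉ g (extent o)) false
                    , Objects.descend-closed g o∈ (subst (_∈ Blocks) child (Features.points-block f∈))
        ; linked    = sym child , inj₁ refl
        ; attained  = ◆≼⇒≼□ g (feature-isExtent f∈) ≤-refl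
        ; dominated = λ { (_ , f′∈) (same , _) → inj₁ (sym same) , ≼□⇒◆≼ g (feature-isExtent f′∈) ≤-refl } }
      through (f , f∈) (inj₂ ((o-root , o-regular) , (f-root , f-regular))) = record
        { row       = point [] (◆ᵉ g (extent o)) true , proj₁ (Objects.root-witnesses o∈ o-root o-regular) g
        ; linked    = sym f-root , inj₂ f-regular
        ; attained  = ◆≼⇒≼□ g (feature-isExtent f∈) ≤-refl
        ; dominated = λ { (_ , f′∈) (root , inj₂ regular) → inj₂ ((o-root , o-regular) , (sym root , regular))
                                                           , ≼□⇒◆≼ g (feature-isExtent f′∈) ≤-refl
                        ; _ (_ , inj₁ ()) } }

  R◇′-row-isIntent′ : ∀ d a → IsIntent′ (λ x → R◇′ d x a)
  R◇′-row-isIntent′ d (o , o∈) = guarded-isIntent′ (λ x → diaLinked? d (proj₁ x) o) _ through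
    where
      through : ∀ x → DiaLinked d (proj₁ x) o → RowWitness _ _ x
      through (f , _) (inj₁ child) = record
        { row       = point (path f) (◇ᵉ d (extent o)) false , Objects.ascend-closed d o∈ child
        ; linked    = refl , inj₁ refl
        ; attained  = ≤-refl
        ; dominated = λ { _ (same , _) → inj₁ (trans child (cong (inj₂ d ∷_) same)) , ≤-refl } }
      through (f , _) (inj₂ ((o-root , o-regular) , (f-root , f-regular))) = record
        { row       = point [] (◇ᵉ d (extent o)) true , proj₂ (Objects.root-witnesses o∈ o-root o-regular) d
        ; linked    = sym f-root , inj₂ f-regular
        ; attained  = ≤-refl
        ; dominated = λ { _ (root , inj₂ regular) → inj₂ ((o-root , o-regular) , (sym root , regular)) , ≤-refl
                        ; _ (_ , inj₁ ()) } }

  R◇′-column-isExtent′ : ∀ d x → IsExtent′ (R◇′ d x)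
  R◇′-column-isExtent′ d (f , f∈) = guarded-isExtent′ (λ a → diaLinked? d f (proj₁ a)) _ through
    where
      through : ∀ a → DiaLinked d f (proj₁ a) → ColumnWitness _ _ a
      through (o , o∈) (inj₁ child) = record
        { column    = point (inj₂ d ∷ path f) (■ᵉ d (extent f)) false
                    , Features.descend-closed d f∈ (subst (_∈ Blocks) child (Objects.points-block o∈))
        ; linked    = child , inj₂ refl
        ; attained  = ≼■⇒◇≼ d (feature-isExtent f∈) ≤-refl
        ; dominated = λ { _ (same , _) → inj₁ same , ◇≼⇒≼■ d (feature-isExtent f∈) ≤-refl } }
      through (o , _) (inj₂ ((o-root , o-regular) , (f-root , f-regular))) = record
        { column    = point [] (■ᵉ d (extent f)) true , proj₁ (Features.root-witnesses f∈ f-root f-regular) d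
        ; linked    = o-root , inj₁ o-regular
        ; attained  = ≼■⇒◇≼ d (feature-isExtent f∈) ≤-refl
        ; dominated = λ { _ (root , inj₁ regular) → inj₂ ((root , regular) , (f-root , f-regular))
                                                  , ◇≼⇒≼■ d (feature-isExtent f∈) ≤-refl
                        ; _ (_ , inj₂ ()) } }

  obj′ : ObjName → A′
  obj′ b with b ∈? objNames
  ... | yes b∈ = _ , named-object b∈
  ... | no _   = _ , top-object

  obj′-point : ∀ {b} → b ∈ objNames → proj₁ (obj′ b) ≡ point [] (objExtent (obj b)) false
  obj′-point {b} b∈ with b ∈? objNames
  ... | yes _  = refl
  ... | no b∉ = contradiction b∈ b∉

  feat′ : FeatName → X′
  feat′ y with y ∈? featNames
  ... | yes y∈ = _ , named-feature y∈
  ... | no _   = _ , top-feature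

  feat′-point : ∀ {y} → y ∈ featNames → proj₁ (feat′ y) ≡ point [] (featExtent (feat y)) false
  feat′-point {y} y∈ with y ∈? featNames
  ... | yes _  = refl
  ... | no y∉ = contradiction y∈ y∉

  primIntent : PrimName → X′ → H
  primIntent q x = ext (prim q) ≼ extent (proj₁ x)

  M′ : Interpretation
  M′ = record
    { A = A′ ; X = X′ ; a₀ = _ , top-object ; x₀ = _ , top-feature
    ; I = I′ ; R□ = R□′ ; R◇ = R◇′
    ; R□-compat₀ = λ g x α → IsExtent′⇒stable
        (IsExtent′-resp (λ a → sym (⟨/⟩-≼ α x (R□′ g a))) (IsExtent′-⇒ α (R□′-column-isExtent′ g x)))
    ; R□-compat₁ = λ g a α → IsIntent′⇒stable
        (IsIntent′-resp (λ x → sym (⟨/⟩-≼ α a (λ a′ → R□′ g a′ x))) (IsIntent′-⇒ α (R□′-row-isIntent′ g a)))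
    ; R◇-compat₀ = λ d a α → IsIntent′⇒stable
        (IsIntent′-resp (λ x → sym (⟨/⟩-≼ α a (R◇′ d x))) (IsIntent′-⇒ α (R◇′-row-isIntent′ d a)))
    ; R◇-compat₁ = λ d x α → IsExtent′⇒stable
        (IsExtent′-resp (λ a → sym (⟨/⟩-≼ α x (λ x′ → R◇′ d x′ a))) (IsExtent′-⇒ α (R◇′-column-isExtent′ d x)))
    ; obj = obj′ ; feat = feat′
    ; primExt = λ q → primIntent q ↓′
    ; primInt = λ q → primIntent q ↓′ ↑′
    ; prim-up = λ _ _ → refl
    ; prim-down = λ q → ↓↑↓′ (primIntent q)
    }

  ext′ : Concept → A′ → H
  ext′ = Interpretation.ext M′

  int′ : Concept → X′ → H
  int′ = Interpretation.int M′

  ExtentAt : Path → (A′ → H) → Ext → Set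
  ExtentAt p f E = ∀ a → path (proj₁ a) ≡ p → f a ≡ extent (proj₁ a) ≼ E

  IntentAt : Path → (X′ → H) → Ext → Set
  IntentAt p u E = ∀ x → path (proj₁ x) ≡ p → u x ≡ E ≼ extent (proj₁ x)

  ↑′-IntentAt : ∀ {p f E} → point p E false ∈ Objects.points → ExtentAt p f E → IntentAt p (f ↑′) E
  ↑′-IntentAt {p} {f} {E} c∈ f≡ (x , _) px = ≤-antisym
    (≼-elim c ≤-refl (≤⊤ ⊙ ≼-refl ⊙ ≥-reflexive (f≡ c refl)) ⊙ ≤-reflexive (guard-yes (linked? (proj₁ c) x) (sym px , inj₁ refl)))
    (≼-intro (λ a → guard-intro (linked? (proj₁ a) x) (λ (same , _) → ≼-trans (π₂ ⊙ ≤-reflexive (f≡ a (trans same px))) π₁)))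
    where
      c : A′
      c = point p E false , c∈

  ↓′-ExtentAt : ∀ {p u E} → point p E false ∈ Features.points → IntentAt p u E → ExtentAt p (u ↓′) E
  ↓′-ExtentAt {p} {u} {E} c∈ u≡ (o , _) po = ≤-antisym
    (≼-elim c ≤-refl (≤⊤ ⊙ ≼-refl ⊙ ≥-reflexive (u≡ c refl)) ⊙ ≤-reflexive (guard-yes (linked? o (proj₁ c)) (po , inj₂ refl)))
    (≼-intro (λ x → guard-intro (linked? o (proj₁ x)) (λ (same , _) → ≼-trans π₁ (π₂ ⊙ ≤-reflexive (u≡ x (trans (sym same) po))))))
    where
      c : X′
      c = point p E false , c∈

  -- The last hypothesis is needed because R□′ also links regular root points to each other.
  box-ExtentAt : ∀ g {p C} → point (inj₁ g ∷ p) (ext C) false ∈ Features.points →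
                 IntentAt (inj₁ g ∷ p) (int′ C) (ext C) → (p ≡ [] → IntentAt [] (int′ C) (ext C)) →
                 ExtentAt p (ext′ ([ g ] C)) (□ᵉ g (ext C))
  box-ExtentAt g {p} {C} c∈ int-child int-root (o , _) po = ≤-antisym
    (⋀-lb _ c ⊙ ⊤⇒-elim (≼-refl ⊙ ≥-reflexive (int-child c refl))
              ⊙ ≤-reflexive (guard-yes (boxLinked? g o (proj₁ c)) (inj₁ (cong (inj₁ g ∷_) (sym po)))))
    (⋀-glb _ (λ x → ⇒-intro (guard-intro (boxLinked? g o (proj₁ x)) (λ
      { (inj₁ child) → ≼□-mono g π₁ (π₂ ⊙ ≤-reflexive (int-child x (trans child (cong (inj₁ g ∷_) po))))
      ; (inj₂ ((o-root , _) , (f-root , _))) → ≼□-mono g π₁ (π₂ ⊙ ≤-reflexive (int-root (trans (sym po) o-root) x f-root)) }))))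
    where
      c : X′
      c = point (inj₁ g ∷ p) (ext C) false , c∈

  dia-IntentAt : ∀ d {p C} → point (inj₂ d ∷ p) (ext C) false ∈ Objects.points →
                 ExtentAt (inj₂ d ∷ p) (ext′ C) (ext C) → (p ≡ [] → ExtentAt [] (ext′ C) (ext C)) →
                 IntentAt p (int′ (⟨ d ⟩ C)) (◇ᵉ d (ext C))
  dia-IntentAt d {p} {C} c∈ ext-child ext-root (f , _) pf = ≤-antisym
    (⋀-lb _ c ⊙ ⊤⇒-elim (≼-refl ⊙ ≥-reflexive (ext-child c refl))
              ⊙ ≤-reflexive (guard-yes (diaLinked? d f (proj₁ c)) (inj₁ (cong (inj₂ d ∷_) (sym pf)))))
    (⋀-glb _ (λ a → ⇒-intro (guard-intro (diaLinked? d f (proj₁ a)) (λ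
      { (inj₁ child) → ◇≼-mono d π₁ (π₂ ⊙ ≤-reflexive (ext-child a (trans child (cong (inj₂ d ∷_) pf))))
      ; (inj₂ ((o-root , _) , (f-root , _))) → ◇≼-mono d π₁ (π₂ ⊙ ≤-reflexive (ext-root (trans (sym pf) f-root) a o-root)) }))))
    where
      c : A′
      c = point (inj₂ d ∷ p) (ext C) false , c∈

  truth : ∀ C {p} → Occurs p C → ExtentAt p (ext′ C) (ext C) × IntentAt p (int′ C) (ext C)
  truth (prim q) h = extent-prim , ↑′-IntentAt (occurrence-object h) extent-prim
    where
      extent-prim : ExtentAt _ (ext′ (prim q)) (ext (prim q))
      extent-prim = ↓′-ExtentAt (occurrence-feature h) (λ _ _ → refl)
  truth (C ⊓ D) h = extent-⊓ , ↑′-IntentAt (occurrence-object h) extent-⊓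
    where
      extent-⊓ : ExtentAt _ (ext′ (C ⊓ D)) (ext (C ⊓ D))
      extent-⊓ a pa = trans (cong₂ _∧_ (proj₁ (truth C (Occurs-child h ⊓ˡ)) a pa) (proj₁ (truth D (Occurs-child h ⊓ʳ)) a pa))
                            (≼-∧-distrib (extent (proj₁ a)) (ext C) (ext D))
  truth (C ⊔ D) h = ↓′-ExtentAt (occurrence-feature h) intent-⊔ , intent-⊔
    where
      intent-⊔ : IntentAt _ (int′ (C ⊔ D)) (ext (C ⊔ D))
      intent-⊔ (f , f∈) pf = trans (cong₂ _∧_ (proj₂ (truth C (Occurs-child h ⊔ˡ)) (f , f∈) pf) (proj₂ (truth D (Occurs-child h ⊔ʳ)) (f , f∈) pf))
                                   (sym (ext-⊔-≼ C D (feature-isExtent f∈)))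
  truth ([ g ] C) {p} h = extent-□ , ↑′-IntentAt (occurrence-object h) extent-□
    where
      extent-□ : ExtentAt p (ext′ ([ g ] C)) (ext ([ g ] C))
      extent-□ a pa = trans (box-ExtentAt g {p} {C} (occurrence-feature (Occurs-child h □)) (proj₂ (truth C (Occurs-child h □)))
                                          (λ { refl → proj₂ (truth C (Occurs-reroot h □)) }) a pa)
                            (≼-cong (□ᵉ-ext g C))
  truth (⟨ d ⟩ C) {p} h = ↓′-ExtentAt (occurrence-feature h) intent-◇ , intent-◇
    where
      intent-◇ : IntentAt p (int′ (⟨ d ⟩ C)) (ext (⟨ d ⟩ C))
      intent-◇ = dia-IntentAt d {p} {C} (occurrence-object (Occurs-child h ◇)) (proj₁ (truth C (Occurs-child h ◇)))
                              (λ { refl → proj₁ (truth C (Occurs-reroot h ◇)) })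

  module _ {b y} (b∈ : b ∈ objNames) (y∈ : y ∈ featNames) where
    private
      ob fy : Point
      ob = point [] (objExtent (obj b)) false
      fy = point [] (featExtent (feat y)) false

      at-names : (F : Point → Point → H) → F (proj₁ (obj′ b)) (proj₁ (feat′ y)) ≡ F ob fy
      at-names F = cong₂ F (obj′-point b∈) (feat′-point y∈)

    I′-named : I′ (obj′ b) (feat′ y) ≡ I (obj b) (feat y)
    I′-named = trans (at-names (λ o f → guard (linked? o f) (extent o ≼ extent f)))
                     (trans (guard-yes (linked? ob fy) (refl , inj₁ refl)) (objExtent-≼ (featExtent-isExtent (feat y)) (obj b)))

    R□′-named : ∀ g → R□′ g (obj′ b) (feat′ y) ≡ R□ g (obj b) (feat y)
    R□′-named g = trans (at-names (λ o f → guard (boxLinked? g o f) (extent o ≼ □ᵉ g (extent f))))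
                        (trans (guard-yes (boxLinked? g ob fy) (inj₂ ((refl , refl) , (refl , refl))))
                               (trans (objExtent-≼ (□ᵉ-isExtent g _) (obj b)) (□ᵉ-featExtent g (obj b) (feat y))))

    R◇′-named : ∀ d → R◇′ d (feat′ y) (obj′ b) ≡ R◇ d (feat y) (obj b)
    R◇′-named d = trans (at-names (λ o f → guard (diaLinked? d f o) (◇ᵉ d (extent o) ≼ extent f)))
                        (trans (guard-yes (diaLinked? d fy ob) (inj₂ ((refl , refl) , (refl , refl)))) (◇ᵉ-objExtent d (obj b) (feat y)))

  valuation : ∀ t → (∀ {b} → b ∈ termObjects t → b ∈ objNames) → (∀ {y} → y ∈ termFeatures t → y ∈ featNames) →
              (∀ {C} → C ∈ termConcepts t → C ∈ concepts) → Interpretation.val M′ t ≡ val t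
  valuation (b ∶ C) named _ concept = begin
    ext′ C (obj′ b)                      ≡⟨ proj₁ (truth C (Occurs-concept (concept (here refl)))) (obj′ b) (cong path b≡) ⟩
    extent (proj₁ (obj′ b)) ≼ ext C      ≡⟨ cong (λ o → extent o ≼ ext C) b≡ ⟩
    objExtent (obj b) ≼ ext C            ≡⟨ objExtent-≼ (ext-isExtent C) (obj b) ⟩
    ext C (obj b)                        ∎
    where
      open ≡-Reasoning
      b≡ = obj′-point (named (here refl))
  valuation (y ∷∶ C) _ named concept = begin
    int′ C (feat′ y)                     ≡⟨ proj₂ (truth C (Occurs-concept (concept (here refl)))) (feat′ y) (cong path y≡) ⟩
    ext C ≼ extent (proj₁ (feat′ y))     ≡⟨ cong (λ f → ext C ≼ extent f) y≡ ⟩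
    ext C ≼ featExtent (feat y)          ≡⟨ proj₁ (isFormalConcept C) (feat y) ⟩
    int C (feat y)                       ∎
    where
      open ≡-Reasoning
      y≡ = feat′-point (named (here refl))
  valuation I[ b , y ]    named-b named-y _ = I′-named (named-b (here refl)) (named-y (here refl))
  valuation (R□[ g ] b y) named-b named-y _ = R□′-named (named-b (here refl)) (named-y (here refl)) g
  valuation (R◇[ d ] y b) named-b named-y _ = R◇′-named (named-b (here refl)) (named-y (here refl)) d

  ⊨-transfer : ∀ {φ} → φ ∈ 𝒜 → M ⊨ φ → M′ ⊨ φ
  ⊨-transfer {α ≤ₐ t} φ∈ α≤ = α≤ ⊙ ≥-reflexive (valuation t (objName∈ φ∈) (featName∈ φ∈) (concept∈ φ∈))
  ⊨-transfer {α ≰ₐ t} φ∈ α≰ = λ α≤ → α≰ (α≤ ⊙ ≤-reflexive (valuation t (objName∈ φ∈) (featName∈ φ∈) (concept∈ φ∈)))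

  ⊨ᴬ-transfer : ∀ {ℬ} → (∀ {φ} → φ ∈ ℬ → φ ∈ 𝒜) → M ⊨ᴬ ℬ → M′ ⊨ᴬ ℬ
  ⊨ᴬ-transfer ⊆𝒜 []       = []
  ⊨ᴬ-transfer ⊆𝒜 (s ∷ ss) = ⊨-transfer (⊆𝒜 (here refl)) s ∷ ⊨ᴬ-transfer (⊆𝒜 ∘ there) ss

  size-bounded : Bounded (length Objects.points + length Features.points) (sideConstant nF nG + sideConstant nG nF) 15
  size-bounded = +-bounded (Objects.points-bounded (base-bounded {names = objNames} namedObject objNames-bounded))
                           (Features.points-bounded (base-bounded {names = featNames} namedFeature featNames-bounded))
    where
      base-bounded : ∀ {N : Set} {names : List N} (named : N → Path × Ext) → Bounded (length names) 1 1 →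
                     Bounded (length (([] , ⊤ₑ) ∷ map named names ++ map occurrenceExtent allOccurrences)) 3 3
      base-bounded {names = names} named names-bounded = ≤-bounded
        (ℕ.≤-reflexive (cong suc (trans (List.length-++ (map named names))
          (cong₂ _+_ (List.length-map named names) (List.length-map occurrenceExtent allOccurrences)))))
        (+-bounded (1-bounded 3) (+-bounded (raise-bounded (s≤s z≤n) names-bounded) allOccurrences-bounded))

corollary1 : (𝓗 : CCDHeyting) (nG nF : ℕ) →
    let open LE-FALC 𝓗 nG nF in
    Σ ℕ λ c → Σ ℕ λ k →
      (𝒜 : ABox) → Consistent 𝒜 →
      Σ Interpretation λ M → (M ⊨ᴬ 𝒜) ×
        Σ ℕ λ n → Σ ℕ λ m →
          (A M ↔ Fin n) × (X M ↔ Fin m) × (n + m ≤ c * (aboxSize 𝒜 + 1) ^ k)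
corollary1 𝓗 nG nF = sideConstant nF nG + sideConstant nG nF , 15 , smallModel
  where
    open LE-FALC 𝓗 nG nF

    smallModel : (𝒜 : ABox) → Consistent 𝒜 →
      Σ Interpretation λ M → (M ⊨ᴬ 𝒜) × Σ ℕ λ n → Σ ℕ λ m →
        (A M ↔ Fin n) × (X M ↔ Fin m) × (n + m ≤ (sideConstant nF nG + sideConstant nG nF) * (aboxSize 𝒜 + 1) ^ 15)
    smallModel 𝒜 (M , M⊨𝒜) =
      M′ , ⊨ᴬ-transfer (λ φ∈ → φ∈) M⊨𝒜 , length Objects.points , length Features.points ,
      ∃∈↔Fin Objects.points , ∃∈↔Fin Features.points ,
      subst (λ N → length Objects.points + length Features.points ≤ (sideConstant nF nG + sideConstant nG nF) * N)
            (power-≡ 15) (≤-poly size-bounded)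
      where
        open Filtration 𝓗 nG nF M 𝒜
        open PolynomialBounds (aboxSize 𝒜) using (power-≡; ≤-poly)
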